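{- Let $q$ be an odd prime power with $q\equiv -1 \pmod 3$, and let $L(q)$ be the ternary code of length $2q+2$ generated by $G'=(I_{q+1},U_q)$ (notation as in the context). Then $L(q)$ contains a set of $4q+2$ codewords with all entries in $\{0,1\}$ and of Hamming weight $q+1$ which form the block-by-point incidence matrix of a Hadamard $3$-$(2q+2,q+1,(q-1)/2)$ design $D(q)$ associated with a Paley-Hadamard matrix of type II; namely, $D(q)$ is the Hadamard 3-design obtained from the Hadamard matrix \[H=\begin{pmatrix} I_{q+1}-U_q^T & U_q+I_{q+1}\\ I_{q+1}+U_q^T & U_q-I_{q+1}\end{pmatrix},\] whose first row is the all-one vector, whose rows (with $-1$ read as $2\in GF(3)$) are codewords of $L(q)$, and which is equivalent to a Paley-Hadamard matrix of type II.
   Context: All codes are over $GF(3)$; $-1$ is identified with $2$. For an odd prime power $q$ with $q\equiv -1\pmod 3$, $S_q=(s_{i,j})$ is the $(q+1)\times(q+1)$ matrix with rows and columns labeled by $\infty$ and the elements of $GF(q)$, where $s_{\infty,\infty}=0$, $s_{a,a}=0$, $s_{\infty,a}=1$ for $a\in GF(q)$, $s_{a,\infty}=1$ if $-1$ is a square in $GF(q)$ and $s_{a,\infty}=-1$ otherwise, and for $a\neq b$ in $GF(q)$, $s_{a,b}=1$ if $a-b$ is a square in $GF(q)$ and $s_{a,b}=-1$ otherwise. $U_q$ is obtained from $S_q$ by replacing every nonzero entry in the column labeled $\infty$ by $-1$. $L(q)$ is the ternary code with generator matrix $(I_{q+1},U_q)$. A Hadamard matrix of order $n$ is an $n\times n$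 $(\pm1)$-matrix $H$ with $HH^T=nI$; two Hadamard matrices $H_1,H_2$ are equivalent if $LH_1R=H_2$ for some $\{0,\pm1\}$-monomial matrices $L,R$. The Paley-Hadamard matrices of type II are $H_1(q)=\begin{pmatrix} I+S_q & -I+S_q\\ -I+S_q & -I-S_q\end{pmatrix}$ if $q\equiv 1\pmod 4$ and $H_3(q)=\begin{pmatrix} I+S_q & I+S_q\\ I-S_q & -I+S_q\end{pmatrix}$ if $q\equiv 3\pmod 4$ ($I=I_{q+1}$). If $H$ is a Hadamard matrix of order $4t$ whose first row is all-one, the Hadamard $3$-$(4t,2t,t-1)$ design obtained from $H$ has as points the $4t$ column indices and as blocks, for each row $r$ of $H$ other than the first, the two sets $\{j: r_j=1\}$ and $\{j:r_j=-1\}$ (so $8t-2$ blocks of size $2t$). -}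

module Defs where

open import Level using (0ℓ)
open import Data.Bool using (Bool; true; false; if_then_else_; _∧_)
open import Data.Nat as ℕ using (ℕ; zero; suc; NonZero)
open import Data.Nat.DivMod as NDM using ()
open import Data.Nat.Primality using (Prime)
open import Data.Integer as ℤ using (ℤ; +_; -[1+_])
open import Data.Integer.DivMod using (_%ℕ_)
open import Data.Fin as Fin using (Fin; toℕ)
open import Data.Maybe using (Maybe; just; nothing)
open import Data.Sum using (_⊎_; inj₁; inj₂)
open import Data.Product using (Σ; ∃; ∃-syntax; _×_; _,_)
open import Data.List using (List; tabulate)
open import Data.Bool.ListAction using (any)
open import Function using (_∘_)
open import Function.Bundles using (_↔_; Inverse)
open import Relation.Nullary using (¬_; Dec; yes; no)
open import Relation.Nullary.Decidable using (⌊_⌋)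
open import Relation.Binary.PropositionalEquality using (_≡_; _≢_)
open import Algebra.Structures using (IsCommutativeRing)

IsPrimePower : ℕ → Set
IsPrimePower q = ∃[ p ] ∃[ k ] (Prime p × (1 ℕ.≤ k) × (q ≡ p ℕ.^ k))

record FiniteField (q : ℕ) : Set₁ where
  field
    Carrier : Set
    _+_ _*_ : Carrier → Carrier → Carrier
    -_      : Carrier → Carrier
    0# 1#   : Carrier
    isCommutativeRing : IsCommutativeRing _≡_ _+_ _*_ -_ 0# 1#
    0≢1     : 0# ≢ 1#
    inverse : ∀ x → x ≢ 0# → ∃[ y ] (x * y ≡ 1#)
    _≟_     : (x y : Carrier) → Dec (x ≡ y)
    enum    : Fin q ↔ Carrier

  elem : Fin q → Carrier
  elem = Inverse.to enum

  elements : List Carrier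
  elements = tabulate elem

  isSquare : Carrier → Bool
  isSquare a = any (λ b → ⌊ (b * b) ≟ a ⌋) elements

sumFin : ∀ {A : Set} → (A → A → A) → A → (n : ℕ) → (Fin n → A) → A
sumFin _⊕_ e zero    f = e
sumFin _⊕_ e (suc n) f = f Fin.zero ⊕ sumFin _⊕_ e n (f ∘ Fin.suc)

GF3 : Set
GF3 = Fin 3

_+₃_ : GF3 → GF3 → GF3
a +₃ b = NDM._mod_ (toℕ a ℕ.+ toℕ b) 3

_*₃_ : GF3 → GF3 → GF3
a *₃ b = NDM._mod_ (toℕ a ℕ.* toℕ b) 3

zero₃ one₃ : GF3
zero₃ = Fin.zero
one₃ = Fin.suc Fin.zero

-- reduction of an integer modulo 3 (so -1 ↦ 2)
red3 : ℤ → GF3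
red3 z = NDM._mod_ (z %ℕ 3) 3

module _ {q : ℕ} (F : FiniteField q) where
  open FiniteField F

  -- labels ∞ (= nothing) and the elements of GF(q)
  Lab : Set
  Lab = Maybe Carrier

  Idx : Set
  Idx = Lab ⊎ Lab

  _≟L_ : (x y : Lab) → Dec (x ≡ y)
  nothing ≟L nothing = yes _≡_.refl
  nothing ≟L just _  = no (λ ())
  just _  ≟L nothing = no (λ ())
  just a  ≟L just b with a ≟ b
  ... | yes _≡_.refl = yes _≡_.refl
  ... | no ne = no (λ { _≡_.refl → ne _≡_.refl })

  _≟I_ : (x y : Idx) → Dec (x ≡ y)
  inj₁ x ≟I inj₁ y with x ≟L y
  ... | yes _≡_.refl = yes _≡_.refl
  ... | no ne = no (λ { _≡_.refl → ne _≡_.refl })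
  inj₁ _ ≟I inj₂ _ = no (λ ())
  inj₂ _ ≟I inj₁ _ = no (λ ())
  inj₂ x ≟I inj₂ y with x ≟L y
  ... | yes _≡_.refl = yes _≡_.refl
  ... | no ne = no (λ { _≡_.refl → ne _≡_.refl })

  sumLab : ∀ {A : Set} → (A → A → A) → A → (Lab → A) → A
  sumLab _⊕_ e f = f nothing ⊕ sumFin _⊕_ e q (f ∘ just ∘ elem)

  sumIdx : ∀ {A : Set} → (A → A → A) → A → (Idx → A) → A
  sumIdx _⊕_ e f = sumLab _⊕_ e (f ∘ inj₁) ⊕ sumLab _⊕_ e (f ∘ inj₂)

  ±1 : Bool → ℤ
  ±1 true  = + 1
  ±1 false = -[1+ 0 ]

  S : Lab → Lab → ℤ
  S nothing  nothing  = + 0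
  S nothing  (just a) = + 1
  S (just a) nothing  = ±1 (isSquare (- 1#))
  S (just a) (just b) with a ≟ b
  ... | yes _ = + 0
  ... | no  _ = ±1 (isSquare (a + (- b)))

  U : Lab → Lab → ℤ
  U i nothing with S i nothing
  ... | + 0 = + 0
  ... | _   = -[1+ 0 ]
  U i (just b) = S i (just b)

  Id : Lab → Lab → ℤ
  Id i j = if ⌊ i ≟L j ⌋ then + 1 else + 0

  Mat : Set
  Mat = Idx → Idx → ℤ

  _·_ : Mat → Mat → Mat
  (A · B) i k = sumIdx ℤ._+_ (+ 0) (λ j → A i j ℤ.* B j k)

  transpose : Mat → Mat
  transpose A i j = A j i

  block : (Lab → Lab → ℤ) → (Lab → Lab → ℤ) → (Lab → Lab → ℤ) → (Lab → Lab → ℤ) → Mat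
  block A B C D (inj₁ i) (inj₁ j) = A i j
  block A B C D (inj₁ i) (inj₂ j) = B i j
  block A B C D (inj₂ i) (inj₁ j) = C i j
  block A B C D (inj₂ i) (inj₂ j) = D i j

  IdI : Mat
  IdI i j = if ⌊ i ≟I j ⌋ then + 1 else + 0

  IsHadamard : Mat → Set
  IsHadamard H = (∀ i j → (H i j ≡ + 1) ⊎ (H i j ≡ -[1+ 0 ]))
               × (∀ i k → (H · transpose H) i k ≡ (+ (2 ℕ.* q ℕ.+ 2)) ℤ.* IdI i k)

  IsMonomial : Mat → Set
  IsMonomial M = (∀ i j → (M i j ≡ + 0) ⊎ (M i j ≡ + 1) ⊎ (M i j ≡ -[1+ 0 ]))
               × (∀ i → ∃[ j ] (M i j ≢ + 0 × (∀ j′ → M i j′ ≢ + 0 → j′ ≡ j)))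
               × (∀ j → ∃[ i ] (M i j ≢ + 0 × (∀ i′ → M i′ j ≢ + 0 → i′ ≡ i)))

  HadamardEquiv : Mat → Mat → Set
  HadamardEquiv H₁ H₂ = ∃[ L ] ∃[ R ] (IsMonomial L × IsMonomial R × (∀ i j → ((L · H₁) · R) i j ≡ H₂ i j))

  private
    _⊞_ _⊟_ : (Lab → Lab → ℤ) → (Lab → Lab → ℤ) → Lab → Lab → ℤ
    (A ⊞ B) i j = A i j ℤ.+ B i j
    (A ⊟ B) i j = A i j ℤ.- B i j
    neg : (Lab → Lab → ℤ) → Lab → Lab → ℤ
    neg A i j = ℤ.- A i j
    tr : (Lab → Lab → ℤ) → Lab → Lab → ℤ
    tr A i j = A j i

  H₁ : Mat
  H₁ = block (Id ⊞ S) (S ⊟ Id) (S ⊟ Id) (neg Id ⊟ S)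

  H₃ : Mat
  H₃ = block (Id ⊞ S) (Id ⊞ S) (Id ⊟ S) (S ⊟ Id)

  H : Mat
  H = block (Id ⊟ tr U) (U ⊞ Id) (Id ⊞ tr U) (U ⊟ Id)

  first : Idx
  first = inj₁ nothing

  Word : Set
  Word = Idx → GF3

  G′ : Lab → Idx → GF3
  G′ i (inj₁ j) = red3 (Id i j)
  G′ i (inj₂ j) = red3 (U i j)

  InL : Word → Set
  InL c = Σ (Lab → GF3) λ x → (∀ j → c j ≡ sumLab _+₃_ zero₃ (λ i → x i *₃ G′ i j))

  rowGF3 : Mat → Idx → Word
  rowGF3 M r j = red3 (M r j)

  -- Hadamard design from a Hadamard matrix with all-one first row:
  -- blocks indexed by (r , s) with r ≢ first; s = true: {j : H r j = 1},
  -- s = false: {j : H r j = -1}.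

  inBlock : Mat → Idx → Bool → Idx → Bool
  inBlock M r s j = ⌊ M r j ℤ.≟ ±1 s ⌋

  blockWord : Mat → Idx → Bool → Word
  blockWord M r s j = if inBlock M r s j then one₃ else zero₃

  countIdx : (Idx → Bool) → ℕ
  countIdx P = sumIdx ℕ._+_ 0 (λ j → if P j then 1 else 0)

  weight : Word → ℕ
  weight c = countIdx (λ j → if ⌊ c j Fin.≟ zero₃ ⌋ then false else true)

  countBlocks3 : Mat → Idx → Idx → Idx → ℕ
  countBlocks3 M x y z = countIdx (cnt true) ℕ.+ countIdx (cnt false)
    where
      cnt : Bool → Idx → Bool
      cnt s r = if ⌊ r ≟I first ⌋ then false
                else (inBlock M r s x ∧ inBlock M r s y ∧ inBlock M r s z)

-- The quadratic character χ of GF(q) is multiplicative and sums to 0, and its Jacobi sums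
-- ∑_c χ(c - a) χ(c - b) equal q·[a = b] - 1; this gives U Uᵀ = Uᵀ U = q I.  In each half, every
-- row and every column of H is a combination a·I + b·U + c·Uᵀ, so the orthogonality of the rows
-- and of the columns of H reduces to arithmetic on the coefficients.  As q ≡ -1 (mod 3),
-- (I ∓ Uᵀ) U = U ∓ q I ≡ U ± I, so each row of H, and with it each block indicator 2 (1 + s·h) of
-- the design, reduces mod 3 to a codeword (x, x U) of L(q).  Column orthogonality gives the design
-- count 4 λ + 4 = 2 q + 2.  Finally -1 is a square exactly when q ≡ 1 (mod 4) (pair x with -x,
-- resp. x⁻¹, among the nonzero squares); then S is symmetric and H is a signed permutation of H₁,
-- otherwise S is skew and H = H₃.

module Submission where

open import Defs
open import Level using (0ℓ)
open import Algebra.Bundles using (AbelianGroup; CommutativeRing)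
import Algebra.Properties.CommutativeMonoid.Sum as MonoidSum
import Algebra.Properties.Ring as RingProperties
import Algebra.Properties.Group as GroupProperties
open import Data.Bool using (Bool; true; false; if_then_else_; _∧_; not)
open import Data.Bool.Properties using (T-≡; ∧-identityʳ)
open import Data.Empty using (⊥-elim)
open import Data.Fin as Fin using (Fin; toℕ; zero; suc)
import Data.Fin.Properties as FinP
open import Data.Fin.Permutation using (permutation)
open import Data.Integer as ℤ using (ℤ; +_; -[1+_])
open import Data.Integer.DivMod using (n%ℕd<d)
import Data.Integer.Properties as ℤP
open import Data.Integer.Tactic.RingSolver using (solve-∀)
open import Data.List.Relation.Unary.Any.Properties using (any⁺; any⁻; tabulate⁺; tabulate⁻)
open import Data.Maybe using (just; nothing)
open import Data.Nat as ℕ using (ℕ; zero; suc; s≤s)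
import Data.Nat.DivMod as ℕDM
import Data.Nat.Properties as ℕP
import Data.Nat.Tactic.RingSolver as ℕSolver
open import Data.Product using (∃-syntax; _×_; _,_; proj₁; proj₂)
open import Data.Sum using (_⊎_; inj₁; inj₂)
open import Function using (_∘_; id)
open import Function.Bundles using (Equivalence; Inverse)
open import Relation.Binary.PropositionalEquality hiding (J)
open import Relation.Nullary using (Dec; yes; no)
open import Relation.Nullary.Decidable using (⌊_⌋; toWitness; fromWitness)

+ℤ-cancelˡ : ∀ a {b c} → a ℤ.+ b ≡ a ℤ.+ c → b ≡ c
+ℤ-cancelˡ a {b} {c} = GroupProperties.∙-cancelˡ (AbelianGroup.group ℤP.+-0-abelianGroup) a b c

true≢false : true ≢ false
true≢false ()

𝟙 : Bool → ℤ
𝟙 true = + 1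
𝟙 false = + 0

module FinSum where

  open import Data.Integer using (_+_; _*_; -_)

  ∑ : (n : ℕ) → (Fin n → ℤ) → ℤ
  ∑ n f = sumFin _+_ (+ 0) n f

  private
    module Σℤ = MonoidSum ℤP.+-0-commutativeMonoid

    ∑≡sum : ∀ n (f : Fin n → ℤ) → ∑ n f ≡ Σℤ.sum f
    ∑≡sum zero f = refl
    ∑≡sum (suc n) f = cong (_+_ (f zero)) (∑≡sum n (f ∘ suc))

  ∑-cong : ∀ n {f g : Fin n → ℤ} → (∀ i → f i ≡ g i) → ∑ n f ≡ ∑ n g
  ∑-cong zero f≗g = refl
  ∑-cong (suc n) f≗g = cong₂ _+_ (f≗g zero) (∑-cong n (f≗g ∘ suc))

  ∑-distrib-+ : ∀ n (f g : Fin n → ℤ) → ∑ n (λ i → f i + g i) ≡ ∑ n f + ∑ n g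
  ∑-distrib-+ zero f g = refl
  ∑-distrib-+ (suc n) f g =
    trans (cong (_+_ (f zero + g zero)) (∑-distrib-+ n (f ∘ suc) (g ∘ suc)))
          (middle-swap (f zero) (g zero) _ _)
    where
    middle-swap : ∀ a b c d → (a + b) + (c + d) ≡ (a + c) + (b + d)
    middle-swap = solve-∀

  ∑-*ˡ : ∀ n c (f : Fin n → ℤ) → ∑ n (λ i → c * f i) ≡ c * ∑ n f
  ∑-*ˡ zero c f = sym (ℤP.*-zeroʳ c)
  ∑-*ˡ (suc n) c f =
    trans (cong (_+_ (c * f zero)) (∑-*ˡ n c (f ∘ suc))) (sym (ℤP.*-distribˡ-+ c _ _))

  ∑-neg : ∀ n (f : Fin n → ℤ) → ∑ n (λ i → - f i) ≡ - ∑ n f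
  ∑-neg n f = trans (∑-cong n (λ i → sym (ℤP.-1*i≡-i (f i))))
                    (trans (∑-*ˡ n -[1+ 0 ] f) (ℤP.-1*i≡-i (∑ n f)))

  ∑-const : ∀ n c → ∑ n (λ _ → c) ≡ + n * c
  ∑-const zero c = sym (ℤP.*-zeroˡ c)
  ∑-const (suc n) c = trans (cong (_+_ c) (∑-const n c)) (sym (ℤP.suc-* (+ n) c))

  ∑-permute : ∀ n (f : Fin n → ℤ) (σ σ⁻¹ : Fin n → Fin n) →
              (∀ i → σ (σ⁻¹ i) ≡ i) → (∀ i → σ⁻¹ (σ i) ≡ i) → ∑ n f ≡ ∑ n (f ∘ σ)
  ∑-permute n f σ σ⁻¹ inverseˡ inverseʳ =
    trans (∑≡sum n f) (trans (Σℤ.sum-permute f (permutation σ σ⁻¹ inverseˡ inverseʳ)) (sym (∑≡sum n (f ∘ σ))))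

  ∑-comm : ∀ m n (f : Fin m → Fin n → ℤ) → ∑ m (λ i → ∑ n (f i)) ≡ ∑ n (λ j → ∑ m (λ i → f i j))
  ∑-comm m n f = begin
    ∑ m (λ i → ∑ n (f i))              ≡⟨ ∑-cong m (λ i → ∑≡sum n (f i)) ⟩
    ∑ m (λ i → Σℤ.sum (f i))           ≡⟨ ∑≡sum m _ ⟩
    Σℤ.sum (λ i → Σℤ.sum (f i))        ≡⟨ Σℤ.∑-comm f ⟩
    Σℤ.sum (λ j → Σℤ.sum (λ i → f i j)) ≡⟨ sym (∑≡sum n _) ⟩
    ∑ n (λ j → Σℤ.sum (λ i → f i j))   ≡⟨ sym (∑-cong n (λ j → ∑≡sum m (λ i → f i j))) ⟩
    ∑ n (λ j → ∑ m (λ i → f i j))      ∎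
    where open ≡-Reasoning

  ∑-δ : ∀ n (m : Fin n) (f : Fin n → ℤ) → ∑ n (λ k → 𝟙 ⌊ k Fin.≟ m ⌋ * f k) ≡ f m
  ∑-δ (suc n) zero f =
    trans (cong₂ _+_ (ℤP.*-identityˡ (f zero)) (trans (∑-cong n off-diagonal) (∑-zero n)))
          (ℤP.+-identityʳ _)
    where
    off-diagonal : ∀ k → 𝟙 ⌊ suc k Fin.≟ zero ⌋ * f (suc k) ≡ + 0
    off-diagonal k = ℤP.*-zeroˡ (f (suc k))
    ∑-zero : ∀ n → ∑ n (λ _ → + 0) ≡ + 0
    ∑-zero n = trans (∑-const n (+ 0)) (ℤP.*-zeroʳ (+ n))
  ∑-δ (suc n) (suc m) f =
    trans (cong₂ _+_ (ℤP.*-zeroˡ (f zero)) (trans (∑-cong n shift) (∑-δ n m (f ∘ suc))))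
          (ℤP.+-identityˡ _)
    where
    shift : ∀ k → 𝟙 ⌊ suc k Fin.≟ suc m ⌋ * f (suc k) ≡ 𝟙 ⌊ k Fin.≟ m ⌋ * f (suc k)
    shift k with k Fin.≟ m
    ... | yes refl = refl
    ... | no _ = refl

  ∑-pos : ∀ n (g : Fin n → ℕ) → ∑ n (λ i → + g i) ≡ + sumFin ℕ._+_ 0 n g
  ∑-pos zero g = refl
  ∑-pos (suc n) g = cong (_+_ (+ g zero)) (∑-pos n (g ∘ suc))

  sumℕ≡0⇒≡0 : ∀ n (g : Fin n → ℕ) → sumFin ℕ._+_ 0 n g ≡ 0 → ∀ i → g i ≡ 0
  sumℕ≡0⇒≡0 (suc n) g sum≡0 zero = ℕP.m+n≡0⇒m≡0 (g zero) sum≡0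
  sumℕ≡0⇒≡0 (suc n) g sum≡0 (suc i) = sumℕ≡0⇒≡0 n (g ∘ suc) (ℕP.m+n≡0⇒n≡0 (g zero) sum≡0) i

open FinSum

module Reduction3 where

  open import Data.Integer using (_+_; _*_; -_)
  open import Data.Fin.Properties using (all?)
  open import Relation.Nullary.Decidable using (_→-dec_)

  two₃ : GF3
  two₃ = suc (suc zero)

  +₃-identityˡ : ∀ a → zero₃ +₃ a ≡ a
  +₃-identityˡ = toWitness {a? = all? λ a → zero₃ +₃ a Fin.≟ a} _

  +₃-assoc : ∀ a b c → (a +₃ b) +₃ c ≡ a +₃ (b +₃ c)
  +₃-assoc = toWitness {a? = all? λ a → all? λ b → all? λ c → (a +₃ b) +₃ c Fin.≟ a +₃ (b +₃ c)} _

  *₃-identityˡ : ∀ a → one₃ *₃ a ≡ a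
  *₃-identityˡ = toWitness {a? = all? λ a → one₃ *₃ a Fin.≟ a} _

  *₃-distribʳ-+₃ : ∀ a b c → (a +₃ b) *₃ c ≡ (a *₃ c) +₃ (b *₃ c)
  *₃-distribʳ-+₃ = toWitness {a? = all? λ a → all? λ b → all? λ c → (a +₃ b) *₃ c Fin.≟ (a *₃ c) +₃ (b *₃ c)} _

  +₃≡0⇒≡two₃*₃ : ∀ a b → a +₃ b ≡ zero₃ → a ≡ two₃ *₃ b
  +₃≡0⇒≡two₃*₃ = toWitness {a? = all? λ a → all? λ b → (a +₃ b Fin.≟ zero₃) →-dec (a Fin.≟ two₃ *₃ b)} _

  toℕ-red3 : ∀ z → toℕ (red3 z) ≡ z ℤ.%ℕ 3
  toℕ-red3 z = trans (FinP.toℕ-fromℕ< _) (ℕDM.m<n⇒m%n≡m (n%ℕd<d z 3))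

  red3-negsuc : ∀ n → red3 -[1+ n ] ≡ two₃ *₃ red3 (+ suc n)
  red3-negsuc n with suc n ℕ.% 3 | ℕDM.m%n<n (suc n) 3
  ... | 0 | _ = refl
  ... | 1 | _ = refl
  ... | 2 | _ = refl
  ... | suc (suc (suc _)) | s≤s (s≤s (s≤s ()))

  red3-suc : ∀ z → red3 (+ 1 + z) ≡ one₃ +₃ red3 z
  red3-suc (+ n) = FinP.toℕ-injective (begin
    toℕ (red3 (+ suc n))                ≡⟨ toℕ-red3 (+ suc n) ⟩
    suc n ℕ.% 3                         ≡⟨ ℕDM.%-distribˡ-+ 1 n 3 ⟩
    (1 ℕ.+ n ℕ.% 3) ℕ.% 3               ≡⟨ cong (λ r → (1 ℕ.+ r) ℕ.% 3) (sym (toℕ-red3 (+ n))) ⟩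
    (1 ℕ.+ toℕ (red3 (+ n))) ℕ.% 3      ≡⟨ sym (FinP.toℕ-fromℕ< _) ⟩
    toℕ (one₃ +₃ red3 (+ n))            ∎)
    where open ≡-Reasoning
  red3-suc -[1+ zero ] = refl
  red3-suc -[1+ suc n ] = begin
    red3 -[1+ n ]                                      ≡⟨ red3-negsuc n ⟩
    two₃ *₃ red3 (+ suc n)                             ≡⟨ two₃-shift (red3 (+ suc n)) ⟩
    one₃ +₃ (two₃ *₃ (one₃ +₃ red3 (+ suc n)))         ≡⟨ cong (λ r → one₃ +₃ (two₃ *₃ r)) (sym (red3-suc (+ suc n))) ⟩
    one₃ +₃ (two₃ *₃ red3 (+ suc (suc n)))             ≡⟨ cong (one₃ +₃_) (sym (red3-negsuc (suc n))) ⟩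
    one₃ +₃ red3 -[1+ suc n ]                          ∎
    where
    open ≡-Reasoning
    two₃-shift : ∀ a → two₃ *₃ a ≡ one₃ +₃ (two₃ *₃ (one₃ +₃ a))
    two₃-shift = toWitness {a? = all? λ a → two₃ *₃ a Fin.≟ one₃ +₃ (two₃ *₃ (one₃ +₃ a))} _

  red3-pred : ∀ z → red3 (-[1+ 0 ] + z) ≡ two₃ +₃ red3 z
  red3-pred z = sym (undo-step (red3 (-[1+ 0 ] + z)) (red3 z) (trans (cong red3 (sym (cancel z))) (red3-suc (-[1+ 0 ] + z))))
    where
    cancel : ∀ z → + 1 + (-[1+ 0 ] + z) ≡ z
    cancel = solve-∀
    undo-step : ∀ a b → b ≡ one₃ +₃ a → two₃ +₃ b ≡ a
    undo-step = toWitness {a? = all? λ a → all? λ b → (b Fin.≟ one₃ +₃ a) →-dec (two₃ +₃ b Fin.≟ a)} _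

  ℤ-induction : (P : ℤ → Set) → P (+ 0) → (∀ z → P z → P (+ 1 + z)) → (∀ z → P z → P (-[1+ 0 ] + z)) → ∀ z → P z
  ℤ-induction P P0 Psuc Ppred (+ zero) = P0
  ℤ-induction P P0 Psuc Ppred (+ suc n) = Psuc (+ n) (ℤ-induction P P0 Psuc Ppred (+ n))
  ℤ-induction P P0 Psuc Ppred -[1+ zero ] = Ppred (+ 0) P0
  ℤ-induction P P0 Psuc Ppred -[1+ suc n ] = Ppred -[1+ n ] (ℤ-induction P P0 Psuc Ppred -[1+ n ])

  red3-+ : ∀ a b → red3 (a + b) ≡ red3 a +₃ red3 b
  red3-+ = ℤ-induction _ (λ b → trans (cong red3 (ℤP.+-identityˡ b)) (sym (+₃-identityˡ (red3 b))))
                         (step (+ 1) red3-suc) (step -[1+ 0 ] red3-pred)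
    where
    step : ∀ ε → (∀ z → red3 (ε + z) ≡ red3 ε +₃ red3 z) →
           ∀ a → (∀ b → red3 (a + b) ≡ red3 a +₃ red3 b) → ∀ b → red3 ((ε + a) + b) ≡ red3 (ε + a) +₃ red3 b
    step ε red3-ε+ a IH b = begin
      red3 ((ε + a) + b)           ≡⟨ cong red3 (ℤP.+-assoc ε a b) ⟩
      red3 (ε + (a + b))           ≡⟨ red3-ε+ (a + b) ⟩
      red3 ε +₃ red3 (a + b)       ≡⟨ cong (red3 ε +₃_) (IH b) ⟩
      red3 ε +₃ (red3 a +₃ red3 b) ≡⟨ sym (+₃-assoc (red3 ε) (red3 a) (red3 b)) ⟩
      (red3 ε +₃ red3 a) +₃ red3 b ≡⟨ cong (_+₃ red3 b) (sym (red3-ε+ a)) ⟩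
      red3 (ε + a) +₃ red3 b       ∎
      where open ≡-Reasoning

  red3-neg : ∀ a → red3 (- a) ≡ two₃ *₃ red3 a
  red3-neg a = +₃≡0⇒≡two₃*₃ _ _ (trans (sym (red3-+ (- a) a)) (cong red3 (ℤP.+-inverseˡ a)))

  red3-* : ∀ a b → red3 (a * b) ≡ red3 a *₃ red3 b
  red3-* = ℤ-induction _ (λ _ → refl) (step (+ 1) (λ b → trans (cong red3 (ℤP.*-identityˡ b)) (sym (*₃-identityˡ (red3 b)))))
                                      (step -[1+ 0 ] (λ b → trans (cong red3 (ℤP.-1*i≡-i b)) (red3-neg b)))
    where
    step : ∀ ε → (∀ b → red3 (ε * b) ≡ red3 ε *₃ red3 b) →
           ∀ a → (∀ b → red3 (a * b) ≡ red3 a *₃ red3 b) → ∀ b → red3 ((ε + a) * b) ≡ red3 (ε + a) *₃ red3 b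
    step ε red3-ε* a IH b = begin
      red3 ((ε + a) * b)                       ≡⟨ cong red3 (ℤP.*-distribʳ-+ b ε a) ⟩
      red3 (ε * b + a * b)                     ≡⟨ red3-+ (ε * b) (a * b) ⟩
      red3 (ε * b) +₃ red3 (a * b)             ≡⟨ cong₂ _+₃_ (red3-ε* b) (IH b) ⟩
      (red3 ε *₃ red3 b) +₃ (red3 a *₃ red3 b)   ≡⟨ sym (*₃-distribʳ-+₃ (red3 ε) (red3 a) (red3 b)) ⟩
      (red3 ε +₃ red3 a) *₃ red3 b             ≡⟨ cong (_*₃ red3 b) (sym (red3-+ ε a)) ⟩
      red3 (ε + a) *₃ red3 b                   ∎
      where open ≡-Reasoning

  red3-∑ : ∀ n (f : Fin n → ℤ) → red3 (∑ n f) ≡ sumFin _+₃_ zero₃ n (red3 ∘ f)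
  red3-∑ zero f = refl
  red3-∑ (suc n) f = trans (red3-+ (f zero) (∑ n (f ∘ suc))) (cong (_+₃_ (red3 (f zero))) (red3-∑ n (f ∘ suc)))

  red3-+-multiple-of-3 : ∀ a s n b → n ℕ.% 3 ≡ 0 → red3 (a + s * (+ n * b)) ≡ red3 a
  red3-+-multiple-of-3 a s n b n%3≡0 = begin
    red3 (a + s * (+ n * b))                  ≡⟨ red3-+ a (s * (+ n * b)) ⟩
    red3 a +₃ red3 (s * (+ n * b))
      ≡⟨ cong (_+₃_ (red3 a)) (trans (red3-* s (+ n * b)) (cong (_*₃_ (red3 s)) (red3-* (+ n) b))) ⟩
    red3 a +₃ (red3 s *₃ (red3 (+ n) *₃ red3 b)) ≡⟨ cong (λ r → red3 a +₃ (red3 s *₃ (r *₃ red3 b))) red3-n≡0 ⟩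
    red3 a +₃ (red3 s *₃ (zero₃ *₃ red3 b))   ≡⟨ absorb (red3 a) (red3 s) (red3 b) ⟩
    red3 a                                    ∎
    where
    open ≡-Reasoning
    red3-n≡0 : red3 (+ n) ≡ zero₃
    red3-n≡0 = FinP.toℕ-injective (trans (toℕ-red3 (+ n)) n%3≡0)
    absorb : ∀ a s b → a +₃ (s *₃ (zero₃ *₃ b)) ≡ a
    absorb = toWitness {a? = all? λ a → all? λ s → all? λ b → a +₃ (s *₃ (zero₃ *₃ b)) Fin.≟ a} _

module Field {q : ℕ} (F : FiniteField q) where

  open FiniteField F public using (Carrier; _≟_; 0≢1; inverse; elem; isSquare)

  commutativeRing : CommutativeRing 0ℓ 0ℓ
  commutativeRing = record { isCommutativeRing = FiniteField.isCommutativeRing F }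

  open CommutativeRing commutativeRing public
    using (_+_; _*_; -_; _-_; 0#; 1#; +-assoc; +-comm; +-identityˡ; +-identityʳ; -‿inverseˡ; -‿inverseʳ;
           *-assoc; *-comm; *-identityˡ; *-identityʳ; distribˡ; distribʳ; zeroˡ; zeroʳ)
  open RingProperties (CommutativeRing.ring commutativeRing) public
    using (-‿involutive; -‿anti-homo-+; -1*x≈-x; -‿distribˡ-*; -‿distribʳ-*; +-cancelˡ; -0#≈0#)
    renaming (x∙y⁻¹≈ε⇒x≈y to x-y≡0⇒x≡y)

  open ≡-Reasoning

  [x+y]-y≡x : ∀ x y → (x + y) - y ≡ x
  [x+y]-y≡x x y = begin
    (x + y) - y   ≡⟨ +-assoc x y (- y) ⟩
    x + (y - y)   ≡⟨ cong (_+_ x) (-‿inverseʳ y) ⟩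
    x + 0#        ≡⟨ +-identityʳ x ⟩
    x             ∎

  [x-y]+y≡x : ∀ x y → (x - y) + y ≡ x
  [x-y]+y≡x x y = begin
    (x - y) + y   ≡⟨ +-assoc x (- y) y ⟩
    x + (- y + y) ≡⟨ cong (_+_ x) (-‿inverseˡ y) ⟩
    x + 0#        ≡⟨ +-identityʳ x ⟩
    x             ∎

  -[x-y]≡y-x : ∀ x y → - (x - y) ≡ y - x
  -[x-y]≡y-x x y = begin
    - (x + - y)    ≡⟨ -‿anti-homo-+ x (- y) ⟩
    - - y + - x    ≡⟨ cong (_+ - x) (-‿involutive y) ⟩
    y - x          ∎

  x-[x-y]≡y : ∀ x y → x - (x - y) ≡ y
  x-[x-y]≡y x y = begin
    x + - (x - y)  ≡⟨ cong (_+_ x) (-[x-y]≡y-x x y) ⟩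
    x + (y - x)    ≡⟨ cong (_+_ x) (+-comm y (- x)) ⟩
    x + (- x + y)  ≡⟨ sym (+-assoc x (- x) y) ⟩
    (x - x) + y    ≡⟨ cong (_+ y) (-‿inverseʳ x) ⟩
    0# + y         ≡⟨ +-identityˡ y ⟩
    y              ∎

  -x*-y≡x*y : ∀ x y → (- x) * (- y) ≡ x * y
  -x*-y≡x*y x y = begin
    (- x) * (- y)  ≡⟨ sym (-‿distribˡ-* x (- y)) ⟩
    - (x * - y)    ≡⟨ cong -_ (sym (-‿distribʳ-* x y)) ⟩
    - - (x * y)    ≡⟨ -‿involutive (x * y) ⟩
    x * y          ∎

  [x*y]²≡x²*y² : ∀ x y → (x * y) * (x * y) ≡ (x * x) * (y * y)
  [x*y]²≡x²*y² x y = begin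
    (x * y) * (x * y)  ≡⟨ *-assoc x y (x * y) ⟩
    x * (y * (x * y))  ≡⟨ cong (x *_) (sym (*-assoc y x y)) ⟩
    x * ((y * x) * y)  ≡⟨ cong (λ z → x * (z * y)) (*-comm y x) ⟩
    x * ((x * y) * y)  ≡⟨ cong (x *_) (*-assoc x y y) ⟩
    x * (x * (y * y))  ≡⟨ sym (*-assoc x x (y * y)) ⟩
    (x * x) * (y * y)  ∎

  [x-y]*[x+y]≡x²-y² : ∀ x y → (x - y) * (x + y) ≡ x * x - y * y
  [x-y]*[x+y]≡x²-y² x y = begin
    (x - y) * (x + y)                       ≡⟨ distribʳ (x + y) x (- y) ⟩
    x * (x + y) + (- y) * (x + y)           ≡⟨ cong₂ _+_ (distribˡ x x y) (sym (-‿distribˡ-* y (x + y))) ⟩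
    (x * x + x * y) + - (y * (x + y))       ≡⟨ cong (λ z → (x * x + x * y) + - z) (distribˡ y x y) ⟩
    (x * x + x * y) + - (y * x + y * y)     ≡⟨ cong (λ z → (x * x + x * y) + - (z + y * y)) (*-comm y x) ⟩
    (x * x + x * y) + - (x * y + y * y)     ≡⟨ cong (_+_ (x * x + x * y)) (-‿anti-homo-+ (x * y) (y * y)) ⟩
    (x * x + x * y) + (- (y * y) + - (x * y)) ≡⟨ +-assoc (x * x) (x * y) _ ⟩
    x * x + (x * y + (- (y * y) + - (x * y))) ≡⟨ cong (_+_ (x * x)) (+-comm (x * y) _) ⟩
    x * x + ((- (y * y) + - (x * y)) + x * y) ≡⟨ cong (_+_ (x * x)) ([x-y]+y≡x (- (y * y)) (x * y)) ⟩
    x * x - y * y                           ∎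

  x*y≡0⇒x≡0∨y≡0 : ∀ x y → x * y ≡ 0# → x ≡ 0# ⊎ y ≡ 0#
  x*y≡0⇒x≡0∨y≡0 x y xy≡0 with x ≟ 0#
  ... | yes x≡0 = inj₁ x≡0
  ... | no x≢0 with inverse x x≢0
  ... | x⁻¹ , xx⁻¹≡1 = inj₂ (begin
    y                ≡⟨ sym (*-identityˡ y) ⟩
    1# * y           ≡⟨ cong (_* y) (sym (trans (*-comm x⁻¹ x) xx⁻¹≡1)) ⟩
    (x⁻¹ * x) * y    ≡⟨ *-assoc x⁻¹ x y ⟩
    x⁻¹ * (x * y)    ≡⟨ cong (x⁻¹ *_) xy≡0 ⟩
    x⁻¹ * 0#         ≡⟨ zeroʳ x⁻¹ ⟩
    0#               ∎)

  x≢0∧y≢0⇒x*y≢0 : ∀ {x y} → x ≢ 0# → y ≢ 0# → x * y ≢ 0#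
  x≢0∧y≢0⇒x*y≢0 {x} {y} x≢0 y≢0 xy≡0 with x*y≡0⇒x≡0∨y≡0 x y xy≡0
  ... | inj₁ x≡0 = x≢0 x≡0
  ... | inj₂ y≡0 = y≢0 y≡0

  x*x≡0⇒x≡0 : ∀ x → x * x ≡ 0# → x ≡ 0#
  x*x≡0⇒x≡0 x xx≡0 with x*y≡0⇒x≡0∨y≡0 x x xx≡0
  ... | inj₁ x≡0 = x≡0
  ... | inj₂ x≡0 = x≡0

  x²≡y²⇒x≡y∨x≡-y : ∀ x y → x * x ≡ y * y → x ≡ y ⊎ x ≡ - y
  x²≡y²⇒x≡y∨x≡-y x y x²≡y² with x*y≡0⇒x≡0∨y≡0 (x - y) (x + y) difference≡0
    where
    difference≡0 : (x - y) * (x + y) ≡ 0#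
    difference≡0 = trans ([x-y]*[x+y]≡x²-y² x y) (trans (cong (_- (y * y)) x²≡y²) (-‿inverseʳ (y * y)))
  ... | inj₁ x-y≡0 = inj₁ (x-y≡0⇒x≡y x y x-y≡0)
  ... | inj₂ x+y≡0 = inj₂ (begin
    x             ≡⟨ sym ([x+y]-y≡x x y) ⟩
    (x + y) - y   ≡⟨ cong (_- y) x+y≡0 ⟩
    0# - y        ≡⟨ +-identityˡ (- y) ⟩
    - y           ∎)

  x+x≡[1+1]*x : ∀ x → x + x ≡ (1# + 1#) * x
  x+x≡[1+1]*x x = sym (trans (distribʳ x 1# 1#) (cong₂ _+_ (*-identityˡ x) (*-identityˡ x)))

  x*c+x≡x*[c+1] : ∀ x c → x * c + x ≡ x * (c + 1#)
  x*c+x≡x*[c+1] x c = trans (cong (_+_ (x * c)) (sym (*-identityʳ x))) (sym (distribˡ x c 1#))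

  [a-c]*[b-c]≡[c-a]*[c-b] : ∀ a b c → (a - c) * (b - c) ≡ (c - a) * (c - b)
  [a-c]*[b-c]≡[c-a]*[c-b] a b c = begin
    (a - c) * (b - c)          ≡⟨ sym (-x*-y≡x*y (a - c) (b - c)) ⟩
    - (a - c) * - (b - c)      ≡⟨ cong₂ _*_ (-[x-y]≡y-x a c) (-[x-y]≡y-x b c) ⟩
    (c - a) * (c - b)          ∎

  -1≢0 : - 1# ≢ 0#
  -1≢0 -1≡0 = 0≢1 (sym (trans (sym (-‿involutive 1#)) (trans (cong -_ -1≡0) -0#≈0#)))

  x≡-x⇒x≡0 : 1# + 1# ≢ 0# → ∀ x → x ≡ - x → x ≡ 0#
  x≡-x⇒x≡0 2≢0 x x≡-x with x*y≡0⇒x≡0∨y≡0 (1# + 1#) x 2x≡0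
    where
    2x≡0 : (1# + 1#) * x ≡ 0#
    2x≡0 = trans (sym (x+x≡[1+1]*x x)) (trans (cong (_+_ x) x≡-x) (-‿inverseʳ x))
  ... | inj₁ 2≡0 = ⊥-elim (2≢0 2≡0)
  ... | inj₂ x≡0 = x≡0

  -- junk value: 0⁻¹ = 0
  _⁻¹ : Carrier → Carrier
  x ⁻¹ with x ≟ 0#
  ... | yes _ = 0#
  ... | no x≢0 = proj₁ (inverse x x≢0)

  0⁻¹≡0 : 0# ⁻¹ ≡ 0#
  0⁻¹≡0 with 0# ≟ 0#
  ... | yes _ = refl
  ... | no 0≢0 = ⊥-elim (0≢0 refl)

  x*x⁻¹≡1 : ∀ {x} → x ≢ 0# → x * x ⁻¹ ≡ 1#
  x*x⁻¹≡1 {x} x≢0 with x ≟ 0#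
  ... | yes x≡0 = ⊥-elim (x≢0 x≡0)
  ... | no x≢0′ = proj₂ (inverse x x≢0′)

  x⁻¹*[x*y]≡y : ∀ {x} → x ≢ 0# → ∀ y → x ⁻¹ * (x * y) ≡ y
  x⁻¹*[x*y]≡y {x} x≢0 y = begin
    x ⁻¹ * (x * y)    ≡⟨ sym (*-assoc (x ⁻¹) x y) ⟩
    (x ⁻¹ * x) * y    ≡⟨ cong (_* y) (trans (*-comm (x ⁻¹) x) (x*x⁻¹≡1 x≢0)) ⟩
    1# * y            ≡⟨ *-identityˡ y ⟩
    y                 ∎

  x*[x⁻¹*y]≡y : ∀ {x} → x ≢ 0# → ∀ y → x * (x ⁻¹ * y) ≡ y
  x*[x⁻¹*y]≡y {x} x≢0 y = begin
    x * (x ⁻¹ * y)    ≡⟨ sym (*-assoc x (x ⁻¹) y) ⟩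
    (x * x ⁻¹) * y    ≡⟨ cong (_* y) (x*x⁻¹≡1 x≢0) ⟩
    1# * y            ≡⟨ *-identityˡ y ⟩
    y                 ∎

  x*y≡1⇒x⁻¹≡y : ∀ {x y} → x * y ≡ 1# → x ⁻¹ ≡ y
  x*y≡1⇒x⁻¹≡y {x} {y} xy≡1 = begin
    x ⁻¹               ≡⟨ sym (*-identityʳ (x ⁻¹)) ⟩
    x ⁻¹ * 1#          ≡⟨ cong (_*_ (x ⁻¹)) (sym xy≡1) ⟩
    x ⁻¹ * (x * y)     ≡⟨ x⁻¹*[x*y]≡y x≢0 y ⟩
    y                  ∎
    where
    x≢0 : x ≢ 0#
    x≢0 x≡0 = 0≢1 (trans (sym (zeroˡ y)) (trans (cong (_* y) (sym x≡0)) xy≡1))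

  ⁻¹-involutive : ∀ x → x ⁻¹ ⁻¹ ≡ x
  ⁻¹-involutive x with x ≟ 0#
  ... | yes x≡0 = trans 0⁻¹≡0 (sym x≡0)
  ... | no x≢0 = x*y≡1⇒x⁻¹≡y (trans (*-comm _ x) (proj₂ (inverse x x≢0)))

  open import Data.Integer as Int using () renaming (_+_ to _+ℤ_; _*_ to _*ℤ_; -_ to -ℤ_)

  infix 4 _==_
  _==_ : Carrier → Carrier → Bool
  x == y = ⌊ x ≟ y ⌋

  ==-refl : ∀ x → (x == x) ≡ true
  ==-refl x with x ≟ x
  ... | yes _ = refl
  ... | no x≢x = ⊥-elim (x≢x refl)

  ≢⇒==-false : ∀ {x y} → x ≢ y → (x == y) ≡ false
  ≢⇒==-false {x} {y} x≢y with x ≟ y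
  ... | yes x≡y = ⊥-elim (x≢y x≡y)
  ... | no _ = refl

  ==-sym : ∀ x y → (x == y) ≡ (y == x)
  ==-sym x y with x ≟ y | y ≟ x
  ... | yes _ | yes _ = refl
  ... | no _ | no _ = refl
  ... | yes x≡y | no y≢x = ⊥-elim (y≢x (sym x≡y))
  ... | no x≢y | yes y≡x = ⊥-elim (x≢y (sym y≡x))

  private
    from : Carrier → Fin q
    from = Inverse.from (FiniteField.enum F)

    elem-from : ∀ x → elem (from x) ≡ x
    elem-from = Inverse.strictlyInverseˡ (FiniteField.enum F)

    from-elem : ∀ i → from (elem i) ≡ i
    from-elem = Inverse.strictlyInverseʳ (FiniteField.enum F)

  ∑C : (Carrier → ℤ) → ℤ
  ∑C f = ∑ q (f ∘ elem)

  ∑C-cong : ∀ {f g : Carrier → ℤ} → (∀ x → f x ≡ g x) → ∑C f ≡ ∑C g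
  ∑C-cong f≗g = ∑-cong q (f≗g ∘ elem)

  ∑C-distrib-+ : ∀ (f g : Carrier → ℤ) → ∑C (λ x → f x +ℤ g x) ≡ ∑C f +ℤ ∑C g
  ∑C-distrib-+ f g = ∑-distrib-+ q (f ∘ elem) (g ∘ elem)

  ∑C-neg : ∀ (f : Carrier → ℤ) → ∑C (λ x → -ℤ f x) ≡ -ℤ ∑C f
  ∑C-neg f = ∑-neg q (f ∘ elem)

  ∑C-*ˡ : ∀ c (f : Carrier → ℤ) → ∑C (λ x → c *ℤ f x) ≡ c *ℤ ∑C f
  ∑C-*ˡ c f = ∑-*ˡ q c (f ∘ elem)

  ∑C-const : ∀ c → ∑C (λ _ → c) ≡ + q *ℤ c
  ∑C-const c = ∑-const q c

  ∑C-comm : ∀ (f : Carrier → Carrier → ℤ) → ∑C (λ x → ∑C (f x)) ≡ ∑C (λ y → ∑C (λ x → f x y))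
  ∑C-comm f = ∑-comm q q (λ i j → f (elem i) (elem j))

  ∑C-reindex : ∀ (f : Carrier → ℤ) (π π⁻¹ : Carrier → Carrier) →
               (∀ x → π (π⁻¹ x) ≡ x) → (∀ x → π⁻¹ (π x) ≡ x) → ∑C f ≡ ∑C (f ∘ π)
  ∑C-reindex f π π⁻¹ inverseˡ inverseʳ =
    trans (∑-permute q (f ∘ elem) σ σ⁻¹ (conjugate π π⁻¹ inverseˡ) (conjugate π⁻¹ π inverseʳ))
          (∑-cong q (λ i → cong f (elem-from (π (elem i)))))
    where
    σ σ⁻¹ : Fin q → Fin q
    σ i = from (π (elem i))
    σ⁻¹ i = from (π⁻¹ (elem i))
    conjugate : ∀ (g h : Carrier → Carrier) → (∀ x → g (h x) ≡ x) → ∀ i → from (g (elem (from (h (elem i))))) ≡ i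
    conjugate g h gh≡id i = trans (cong (from ∘ g) (elem-from (h (elem i)))) (trans (cong from (gh≡id (elem i))) (from-elem i))

  ∑C-δ : ∀ a (g : Carrier → ℤ) → ∑C (λ x → 𝟙 (a == x) *ℤ g x) ≡ g a
  ∑C-δ a g = trans (∑-cong q (λ i → cong (_*ℤ g (elem i)) (same-indicator i)))
                   (trans (∑-δ q (from a) (g ∘ elem)) (cong g (elem-from a)))
    where
    same-indicator : ∀ i → 𝟙 (a == elem i) ≡ 𝟙 ⌊ i Fin.≟ from a ⌋
    same-indicator i with a ≟ elem i | i Fin.≟ from a
    ... | yes _ | yes _ = refl
    ... | no _ | no _ = refl
    ... | yes a≡i | no i≢a = ⊥-elim (i≢a (trans (sym (from-elem i)) (cong from (sym a≡i))))
    ... | no a≢i | yes i≡a = ⊥-elim (a≢i (trans (sym (elem-from a)) (cong elem (sym i≡a))))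

  ∑C-𝟙-== : ∀ a → ∑C (λ x → 𝟙 (a == x)) ≡ + 1
  ∑C-𝟙-== a = trans (∑C-cong (λ x → sym (ℤP.*-identityʳ (𝟙 (a == x))))) (∑C-δ a (λ _ → + 1))

  count : (Carrier → Bool) → ℕ
  count P = sumFin ℕ._+_ 0 q (λ i → if P (elem i) then 1 else 0)

  ∑C-𝟙≡count : ∀ P → ∑C (𝟙 ∘ P) ≡ + count P
  ∑C-𝟙≡count P = trans (∑C-cong (λ x → 𝟙≡pos (P x))) (∑-pos q (λ i → if P (elem i) then 1 else 0))
    where
    𝟙≡pos : ∀ b → 𝟙 b ≡ + (if b then 1 else 0)
    𝟙≡pos true = refl
    𝟙≡pos false = refl

  count≡0⇒false : ∀ P → count P ≡ 0 → ∀ x → P x ≡ false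
  count≡0⇒false P count≡0 x with P x in Px | sumℕ≡0⇒≡0 q _ count≡0 (from x)
  ... | false | _ = refl
  ... | true | at-x≡0 rewrite elem-from x | Px = ⊥-elim (one≢zero at-x≡0)
    where
    one≢zero : 1 ≢ 0
    one≢zero ()

  ⊆∧equal-count⇒⊇ : ∀ (P Q : Carrier → Bool) → (∀ x → P x ≡ true → Q x ≡ true) →
                     ∑C (𝟙 ∘ P) ≡ ∑C (𝟙 ∘ Q) → ∀ x → Q x ≡ true → P x ≡ true
  ⊆∧equal-count⇒⊇ P Q P⊆Q equal x Qx with P x in Px
  ... | true = refl
  ... | false = ⊥-elim (true≢false (trans (sym Qx∧¬Px) (count≡0⇒false Q∖P no-difference x)))
    where
    Q∖P : Carrier → Bool
    Q∖P y = Q y ∧ not (P y)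
    Qx∧¬Px : Q∖P x ≡ true
    Qx∧¬Px rewrite Qx | Px = refl
    split : ∀ y → 𝟙 (Q y) ≡ 𝟙 (P y) +ℤ 𝟙 (Q∖P y)
    split y with P y in Py | Q y in Qy
    ... | true | true = refl
    ... | true | false = ⊥-elim (true≢false (trans (sym (P⊆Q y Py)) Qy))
    ... | false | true = refl
    ... | false | false = refl
    no-difference : count Q∖P ≡ 0
    no-difference = ℤP.+-injective (+ℤ-cancelˡ (∑C (𝟙 ∘ P)) (begin
      ∑C (𝟙 ∘ P) +ℤ + count Q∖P            ≡⟨ cong (_+ℤ_ (∑C (𝟙 ∘ P))) (sym (∑C-𝟙≡count Q∖P)) ⟩
      ∑C (𝟙 ∘ P) +ℤ ∑C (𝟙 ∘ Q∖P)           ≡⟨ sym (∑C-distrib-+ (𝟙 ∘ P) (𝟙 ∘ Q∖P)) ⟩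
      ∑C (λ y → 𝟙 (P y) +ℤ 𝟙 (Q∖P y))      ≡⟨ sym (∑C-cong split) ⟩
      ∑C (𝟙 ∘ Q)                           ≡⟨ sym equal ⟩
      ∑C (𝟙 ∘ P)                           ≡⟨ sym (ℤP.+-identityʳ _) ⟩
      ∑C (𝟙 ∘ P) +ℤ + 0                    ∎))

  ∑C-𝟙-involution : ∀ (σ : Carrier → Carrier) → (∀ x → σ (σ x) ≡ x) → (P : Carrier → Bool) →
                    (∀ x → P (σ x) ≡ P x) → (∀ x → P x ≡ true → σ x ≢ x) →
                    ∃[ k ] (∑C (𝟙 ∘ P) ≡ + k +ℤ + k)
  ∑C-𝟙-involution σ σσ≡id P P∘σ≡P no-fixed-point =
    count leads , (begin
      ∑C (𝟙 ∘ P)                                       ≡⟨ ∑C-cong split ⟩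
      ∑C (λ x → 𝟙 (leads x) +ℤ 𝟙 (leads (σ x)))        ≡⟨ ∑C-distrib-+ (𝟙 ∘ leads) (𝟙 ∘ leads ∘ σ) ⟩
      ∑C (𝟙 ∘ leads) +ℤ ∑C (𝟙 ∘ leads ∘ σ)
        ≡⟨ cong (_+ℤ_ (∑C (𝟙 ∘ leads))) (sym (∑C-reindex (𝟙 ∘ leads) σ σ σσ≡id σσ≡id)) ⟩
      ∑C (𝟙 ∘ leads) +ℤ ∑C (𝟙 ∘ leads)                 ≡⟨ cong₂ _+ℤ_ (∑C-𝟙≡count leads) (∑C-𝟙≡count leads) ⟩
      + count leads +ℤ + count leads                   ∎)
    where
    open ≡-Reasoning
    position : Carrier → ℕ
    position x = toℕ (from x)
    -- each orbit {x, σ x} inside P has exactly one leader: the element enumerated first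
    leads : Carrier → Bool
    leads x = P x ∧ ⌊ position x ℕ.<? position (σ x) ⌋
    split : ∀ x → 𝟙 (P x) ≡ 𝟙 (leads x) +ℤ 𝟙 (leads (σ x))
    split x rewrite P∘σ≡P x | σσ≡id x with P x in Px
    ... | false = refl
    ... | true with position x ℕ.<? position (σ x) | position (σ x) ℕ.<? position x
    ... | yes _ | no _ = refl
    ... | no _ | yes _ = refl
    ... | yes x<σx | yes σx<x = ⊥-elim (ℕP.<-asym x<σx σx<x)
    ... | no x≮σx | no σx≮x = ⊥-elim (no-fixed-point x Px (sym (begin
      x                 ≡⟨ sym (elem-from x) ⟩
      elem (from x)     ≡⟨ cong elem (FinP.toℕ-injective same-position) ⟩
      elem (from (σ x)) ≡⟨ elem-from (σ x) ⟩
      σ x               ∎)))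
      where
      same-position : position x ≡ position (σ x)
      same-position = ℕP.≤-antisym (ℕP.≮⇒≥ σx≮x) (ℕP.≮⇒≥ x≮σx)

  isSquare-intro : ∀ b a → b * b ≡ a → isSquare a ≡ true
  isSquare-intro b a b²≡a = Equivalence.to T-≡ (any⁺ _ (tabulate⁺ (from b) (fromWitness b′²≡a)))
    where
    b′²≡a : elem (from b) * elem (from b) ≡ a
    b′²≡a = trans (cong (λ c → c * c) (elem-from b)) b²≡a

  isSquare-elim : ∀ a → isSquare a ≡ true → ∃[ b ] (b * b ≡ a)
  isSquare-elim a isSq with tabulate⁻ (any⁻ _ _ (Equivalence.from T-≡ isSq))
  ... | i , witness = elem i , toWitness witness

  0-isSquare : isSquare 0# ≡ true
  0-isSquare = isSquare-intro 0# 0# (zeroˡ 0#)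

  1-isSquare : isSquare 1# ≡ true
  1-isSquare = isSquare-intro 1# 1# (*-identityˡ 1#)

  nonsquare⇒≢0 : ∀ {a} → isSquare a ≡ false → a ≢ 0#
  nonsquare⇒≢0 ¬sq refl = true≢false (trans (sym 0-isSquare) ¬sq)

  square*square : ∀ a b → isSquare a ≡ true → isSquare b ≡ true → isSquare (a * b) ≡ true
  square*square a b sq-a sq-b with isSquare-elim a sq-a | isSquare-elim b sq-b
  ... | c , c²≡a | d , d²≡b = isSquare-intro (c * d) (a * b) (trans ([x*y]²≡x²*y² c d) (cong₂ _*_ c²≡a d²≡b))

  square-cancelˡ : ∀ a b → a ≢ 0# → isSquare a ≡ true → isSquare (a * b) ≡ true → isSquare b ≡ true
  square-cancelˡ a b a≢0 sq-a sq-ab with isSquare-elim a sq-a | isSquare-elim (a * b) sq-ab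
  ... | c , c²≡a | d , d²≡ab = isSquare-intro (d * c ⁻¹) b (begin
    (d * c ⁻¹) * (d * c ⁻¹)   ≡⟨ [x*y]²≡x²*y² d (c ⁻¹) ⟩
    (d * d) * (c ⁻¹ * c ⁻¹)   ≡⟨ cong₂ _*_ (trans d²≡ab (cong (_* b) (sym c²≡a))) refl ⟩
    ((c * c) * b) * (c ⁻¹ * c ⁻¹) ≡⟨ cong (_* (c ⁻¹ * c ⁻¹)) (*-comm (c * c) b) ⟩
    (b * (c * c)) * (c ⁻¹ * c ⁻¹) ≡⟨ *-assoc b (c * c) (c ⁻¹ * c ⁻¹) ⟩
    b * ((c * c) * (c ⁻¹ * c ⁻¹)) ≡⟨ cong (_*_ b) (sym ([x*y]²≡x²*y² c (c ⁻¹))) ⟩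
    b * ((c * c ⁻¹) * (c * c ⁻¹)) ≡⟨ cong (λ u → b * (u * u)) (x*x⁻¹≡1 c≢0) ⟩
    b * (1# * 1#)             ≡⟨ cong (_*_ b) (*-identityˡ 1#) ⟩
    b * 1#                    ≡⟨ *-identityʳ b ⟩
    b                         ∎)
    where
    c≢0 : c ≢ 0#
    c≢0 c≡0 = a≢0 (trans (sym c²≡a) (trans (cong (_* c) c≡0) (zeroˡ c)))

  square⇒⁻¹-square : ∀ a → isSquare a ≡ true → isSquare (a ⁻¹) ≡ true
  square⇒⁻¹-square a sq-a = by-cases (a ≟ 0#)
    where
    by-cases : Dec (a ≡ 0#) → isSquare (a ⁻¹) ≡ true
    by-cases (yes a≡0) = subst (λ x → isSquare x ≡ true) (sym (trans (cong _⁻¹ a≡0) 0⁻¹≡0)) 0-isSquare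
    by-cases (no a≢0) = square-cancelˡ a (a ⁻¹) a≢0 sq-a (subst (λ x → isSquare x ≡ true) (sym (x*x⁻¹≡1 a≢0)) 1-isSquare)

  q≢1 : q ≢ 1
  q≢1 refl = 0≢1 (begin
    0#                 ≡⟨ sym (elem-from 0#) ⟩
    elem (from 0#)     ≡⟨ cong elem (only-index (from 0#) (from 1#)) ⟩
    elem (from 1#)     ≡⟨ elem-from 1# ⟩
    1#                 ∎)
    where
    only-index : ∀ (i j : Fin 1) → i ≡ j
    only-index zero zero = refl

module QuadraticCharacter {q : ℕ} (F : FiniteField q) (q-odd : q ℕ.% 2 ≡ 1) where

  open Field F
  open import Data.Integer using () renaming (_+_ to _+ℤ_; _*_ to _*ℤ_; -_ to -ℤ_)
  open ≡-Reasoning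

  q≢k+k : ∀ k → q ≢ k ℕ.+ k
  q≢k+k k q≡k+k = 0≢1′ (begin
    0                  ≡⟨ sym (ℕDM.m*n%n≡0 k 2) ⟩
    (k ℕ.* 2) ℕ.% 2    ≡⟨ cong (ℕ._% 2) (trans (ℕP.*-comm k 2) (cong (k ℕ.+_) (ℕP.+-identityʳ k))) ⟩
    (k ℕ.+ k) ℕ.% 2    ≡⟨ cong (ℕ._% 2) (sym q≡k+k) ⟩
    q ℕ.% 2            ≡⟨ q-odd ⟩
    1                  ∎)
    where
    0≢1′ : 0 ≢ 1
    0≢1′ ()

  1+1≢0 : 1# + 1# ≢ 0#
  1+1≢0 2≡0 with ∑C-𝟙-involution (_+ 1#) shift-twice (λ _ → true) (λ _ → refl) no-fixed-point
    where
    shift-twice : ∀ x → (x + 1#) + 1# ≡ x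
    shift-twice x = trans (+-assoc x 1# 1#) (trans (cong (_+_ x) 2≡0) (+-identityʳ x))
    no-fixed-point : ∀ x → true ≡ true → x + 1# ≢ x
    no-fixed-point x _ x+1≡x = 0≢1 (sym (+-cancelˡ x 1# 0# (trans x+1≡x (sym (+-identityʳ x)))))
  ... | k , q·1≡k+k = q≢k+k k (ℤP.+-injective (trans (sym (trans (∑C-const (+ 1)) (ℤP.*-identityʳ (+ q)))) q·1≡k+k))

  nonzeroSquare nonsquare : Carrier → Bool
  nonzeroSquare a = not (a == 0#) ∧ isSquare a
  nonsquare a = not (isSquare a)

  #roots : ∀ a → ∑C (λ x → 𝟙 (x * x == a)) ≡ 𝟙 (0# == a) +ℤ (𝟙 (nonzeroSquare a) +ℤ 𝟙 (nonzeroSquare a))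
  #roots a with a ≟ 0# | 0# ≟ a | isSquare a in sq-a
  ... | yes a≡0 | yes _ | _ rewrite a≡0 = trans (∑C-cong only-zero) (∑C-𝟙-== 0#)
    where
    only-zero : ∀ x → 𝟙 (x * x == 0#) ≡ 𝟙 (0# == x)
    only-zero x with (x * x) ≟ 0# | 0# ≟ x
    ... | yes _ | yes _ = refl
    ... | no _ | no _ = refl
    ... | yes x²≡0 | no 0≢x = ⊥-elim (0≢x (sym (x*x≡0⇒x≡0 x x²≡0)))
    ... | no x²≢0 | yes 0≡x = ⊥-elim (x²≢0 (trans (cong (λ z → z * z) (sym 0≡x)) (zeroˡ 0#)))
  ... | yes a≡0 | no 0≢a | _ = ⊥-elim (0≢a (sym a≡0))
  ... | no a≢0 | yes 0≡a | _ = ⊥-elim (a≢0 (sym 0≡a))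
  ... | no a≢0 | no _ | true with isSquare-elim a sq-a
  ...   | d , d²≡a = trans (∑C-cong ±d) (trans (∑C-distrib-+ (λ x → 𝟙 (d == x)) (λ x → 𝟙 (- d == x)))
                                                 (cong₂ _+ℤ_ (∑C-𝟙-== d) (∑C-𝟙-== (- d))))
    where
    d≢0 : d ≢ 0#
    d≢0 d≡0 = a≢0 (trans (sym d²≡a) (trans (cong (λ z → z * z) d≡0) (zeroˡ 0#)))
    ±d : ∀ x → 𝟙 (x * x == a) ≡ 𝟙 (d == x) +ℤ 𝟙 (- d == x)
    ±d x with (x * x) ≟ a | d ≟ x | (- d) ≟ x
    ... | yes _ | yes d≡x | yes -d≡x = ⊥-elim (d≢0 (x≡-x⇒x≡0 1+1≢0 d (trans d≡x (sym -d≡x))))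
    ... | yes _ | yes _ | no _ = refl
    ... | yes _ | no _ | yes _ = refl
    ... | yes x²≡a | no d≢x | no -d≢x with x²≡y²⇒x≡y∨x≡-y x d (trans x²≡a (sym d²≡a))
    ...   | inj₁ x≡d = ⊥-elim (d≢x (sym x≡d))
    ...   | inj₂ x≡-d = ⊥-elim (-d≢x (sym x≡-d))
    ±d x | no x²≢a | yes d≡x | _ = ⊥-elim (x²≢a (trans (cong (λ z → z * z) (sym d≡x)) d²≡a))
    ±d x | no x²≢a | no _ | yes -d≡x = ⊥-elim (x²≢a (trans (cong (λ z → z * z) (sym -d≡x)) (trans (-x*-y≡x*y d d) d²≡a)))
    ±d x | no _ | no _ | no _ = refl
  #roots a | no a≢0 | no _ | false = trans (∑C-cong no-root) (trans (∑C-const (+ 0)) (ℤP.*-zeroʳ (+ q)))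
    where
    no-root : ∀ x → 𝟙 (x * x == a) ≡ + 0
    no-root x with (x * x) ≟ a
    ... | yes x²≡a = ⊥-elim (true≢false (trans (sym (isSquare-intro x a x²≡a)) sq-a))
    ... | no _ = refl

  N : ℤ
  N = ∑C (𝟙 ∘ nonzeroSquare)

  q≡1+2N : + q ≡ + 1 +ℤ (N +ℤ N)
  q≡1+2N = begin
    + q                                                    ≡⟨ sym (trans (∑C-const (+ 1)) (ℤP.*-identityʳ (+ q))) ⟩
    ∑C (λ x → + 1)                                          ≡⟨ ∑C-cong (λ x → sym (∑C-𝟙-== (x * x))) ⟩
    ∑C (λ x → ∑C (λ a → 𝟙 (x * x == a)))                   ≡⟨ ∑C-cong (λ x → ∑C-cong (λ a → cong 𝟙 (==-sym (x * x) a))) ⟩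
    ∑C (λ x → ∑C (λ a → 𝟙 (a == x * x)))                   ≡⟨ ∑C-comm (λ x a → 𝟙 (a == x * x)) ⟩
    ∑C (λ a → ∑C (λ x → 𝟙 (a == x * x)))                   ≡⟨ ∑C-cong (λ a → ∑C-cong (λ x → cong 𝟙 (==-sym a (x * x)))) ⟩
    ∑C (λ a → ∑C (λ x → 𝟙 (x * x == a)))                   ≡⟨ ∑C-cong #roots ⟩
    ∑C (λ a → 𝟙 (0# == a) +ℤ (𝟙 (nonzeroSquare a) +ℤ 𝟙 (nonzeroSquare a)))
                                                           ≡⟨ ∑C-distrib-+ (λ a → 𝟙 (0# == a)) (λ a → 𝟙 (nonzeroSquare a) +ℤ 𝟙 (nonzeroSquare a)) ⟩
    ∑C (λ a → 𝟙 (0# == a)) +ℤ ∑C (λ a → 𝟙 (nonzeroSquare a) +ℤ 𝟙 (nonzeroSquare a))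
                                                           ≡⟨ cong₂ _+ℤ_ (∑C-𝟙-== 0#) (∑C-distrib-+ (𝟙 ∘ nonzeroSquare) (𝟙 ∘ nonzeroSquare)) ⟩
    + 1 +ℤ (N +ℤ N)                                         ∎

  q≡1+N+#nonsquares : + q ≡ + 1 +ℤ (N +ℤ ∑C (𝟙 ∘ nonsquare))
  q≡1+N+#nonsquares = begin
    + q                                                    ≡⟨ sym (trans (∑C-const (+ 1)) (ℤP.*-identityʳ (+ q))) ⟩
    ∑C (λ a → + 1)                                          ≡⟨ ∑C-cong trichotomy ⟩
    ∑C (λ a → 𝟙 (0# == a) +ℤ (𝟙 (nonzeroSquare a) +ℤ 𝟙 (nonsquare a)))
                                                           ≡⟨ ∑C-distrib-+ (λ a → 𝟙 (0# == a)) (λ a → 𝟙 (nonzeroSquare a) +ℤ 𝟙 (nonsquare a)) ⟩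
    ∑C (λ a → 𝟙 (0# == a)) +ℤ ∑C (λ a → 𝟙 (nonzeroSquare a) +ℤ 𝟙 (nonsquare a))
                                                           ≡⟨ cong₂ _+ℤ_ (∑C-𝟙-== 0#) (∑C-distrib-+ (𝟙 ∘ nonzeroSquare) (𝟙 ∘ nonsquare)) ⟩
    + 1 +ℤ (N +ℤ ∑C (𝟙 ∘ nonsquare))                       ∎
    where
    trichotomy : ∀ a → + 1 ≡ 𝟙 (0# == a) +ℤ (𝟙 (nonzeroSquare a) +ℤ 𝟙 (nonsquare a))
    trichotomy a with 0# ≟ a | a ≟ 0# | isSquare a in sq-a
    ... | yes _ | yes _ | true = refl
    ... | yes 0≡a | yes _ | false = ⊥-elim (nonsquare⇒≢0 sq-a (sym 0≡a))
    ... | yes 0≡a | no a≢0 | _ = ⊥-elim (a≢0 (sym 0≡a))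
    ... | no 0≢a | yes a≡0 | _ = ⊥-elim (0≢a (sym a≡0))
    ... | no _ | no _ | true = refl
    ... | no _ | no _ | false = refl

  #nonsquares≡N : ∑C (𝟙 ∘ nonsquare) ≡ N
  #nonsquares≡N = +ℤ-cancelˡ N (+ℤ-cancelˡ (+ 1) (trans (sym q≡1+N+#nonsquares) q≡1+2N))

  nonzeroSquare-elim : ∀ {x} → nonzeroSquare x ≡ true → x ≢ 0# × isSquare x ≡ true
  nonzeroSquare-elim {x} nzsq-x with x ≟ 0# | isSquare x
  ... | no x≢0 | true = x≢0 , refl
  ... | no _ | false = ⊥-elim (true≢false (sym nzsq-x))
  ... | yes _ | _ = ⊥-elim (true≢false (sym nzsq-x))

  -- for a nonsquare a, x ↦ a x maps the N nonzero squares into the N nonsquares, hence onto them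
  nonsquare*nonsquare : ∀ a b → isSquare a ≡ false → isSquare b ≡ false → isSquare (a * b) ≡ true
  nonsquare*nonsquare a b ¬sq-a ¬sq-b with isSquare (a * b) in sq-ab
  ... | true = refl
  ... | false = ⊥-elim (true≢false (trans (sym (proj₂ (nonzeroSquare-elim nzsq-b))) ¬sq-b))
    where
    a≢0 : a ≢ 0#
    a≢0 = nonsquare⇒≢0 ¬sq-a
    a·_ : Carrier → Carrier
    a· x = a * x
    a·nonzeroSquare : ∀ x → nonzeroSquare x ≡ true → nonsquare (a· x) ≡ true
    a·nonzeroSquare x nzsq-x with nonzeroSquare-elim nzsq-x | isSquare (a * x) in sq-ax
    ... | _ | false = refl
    ... | x≢0 , sq-x | true =
      ⊥-elim (true≢false (trans (sym (square-cancelˡ x a x≢0 sq-x (trans (cong isSquare (*-comm x a)) sq-ax))) ¬sq-a))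
    same-count : ∑C (𝟙 ∘ nonzeroSquare) ≡ ∑C (𝟙 ∘ nonsquare ∘ a·_)
    same-count = trans (sym #nonsquares≡N) (∑C-reindex (𝟙 ∘ nonsquare) a·_ (λ x → a ⁻¹ * x) (x*[x⁻¹*y]≡y a≢0) (x⁻¹*[x*y]≡y a≢0))
    nzsq-b : nonzeroSquare b ≡ true
    nzsq-b = ⊆∧equal-count⇒⊇ nonzeroSquare (nonsquare ∘ a·_) a·nonzeroSquare same-count b (cong not sq-ab)

  χ : Carrier → ℤ
  χ a = if a == 0# then + 0 else ±1 F (isSquare a)

  χ-0 : ∀ {a} → a ≡ 0# → χ a ≡ + 0
  χ-0 {a} a≡0 with a ≟ 0#
  ... | yes _ = refl
  ... | no a≢0 = ⊥-elim (a≢0 a≡0)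

  χ-≢0 : ∀ {a} → a ≢ 0# → χ a ≡ ±1 F (isSquare a)
  χ-≢0 {a} a≢0 with a ≟ 0#
  ... | yes a≡0 = ⊥-elim (a≢0 a≡0)
  ... | no _ = refl

  χ-* : ∀ a b → χ (a * b) ≡ χ a *ℤ χ b
  χ-* a b = by-cases (a ≟ 0#) (b ≟ 0#)
    where
    by-cases : Dec (a ≡ 0#) → Dec (b ≡ 0#) → χ (a * b) ≡ χ a *ℤ χ b
    by-cases (yes a≡0) _ = trans (χ-0 (trans (cong (_* b) a≡0) (zeroˡ b))) (sym (cong (_*ℤ χ b) (χ-0 a≡0)))
    by-cases (no _) (yes b≡0) =
      trans (χ-0 (trans (cong (_*_ a) b≡0) (zeroʳ a))) (sym (trans (cong (_*ℤ_ (χ a)) (χ-0 b≡0)) (ℤP.*-zeroʳ (χ a))))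
    by-cases (no a≢0) (no b≢0) rewrite χ-≢0 (x≢0∧y≢0⇒x*y≢0 a≢0 b≢0) | χ-≢0 a≢0 | χ-≢0 b≢0
      with isSquare a in sq-a | isSquare b in sq-b
    ... | true | true rewrite square*square a b sq-a sq-b = refl
    ... | false | false rewrite nonsquare*nonsquare a b sq-a sq-b = refl
    ... | true | false with isSquare (a * b) in sq-ab
    ...   | true = ⊥-elim (true≢false (trans (sym (square-cancelˡ a b a≢0 sq-a sq-ab)) sq-b))
    ...   | false = refl
    by-cases (no a≢0) (no b≢0) | false | true with isSquare (a * b) in sq-ab
    ...   | true = ⊥-elim (true≢false (trans (sym (square-cancelˡ b a b≢0 sq-b (trans (cong isSquare (*-comm b a)) sq-ab))) sq-a))
    ...   | false = refl

  χ² : ∀ a → χ a *ℤ χ a ≡ 𝟙 (not (a == 0#))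
  χ² a with a ≟ 0#
  ... | yes _ = refl
  ... | no _ with isSquare a
  ...   | true = refl
  ...   | false = refl

  χ²≡1 : ∀ {a} → a ≢ 0# → χ a *ℤ χ a ≡ + 1
  χ²≡1 {a} a≢0 = trans (χ² a) (cong (𝟙 ∘ not) (≢⇒==-false a≢0))

  χ[b-a]≡χ[-1]*χ[a-b] : ∀ a b → χ (b - a) ≡ ±1 F (isSquare (- 1#)) *ℤ χ (a - b)
  χ[b-a]≡χ[-1]*χ[a-b] a b = begin
    χ (b - a)                              ≡⟨ cong χ (sym (trans (-1*x≈-x (a - b)) (-[x-y]≡y-x a b))) ⟩
    χ (- 1# * (a - b))                     ≡⟨ χ-* (- 1#) (a - b) ⟩
    χ (- 1#) *ℤ χ (a - b)                  ≡⟨ cong (_*ℤ χ (a - b)) (χ-≢0 -1≢0) ⟩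
    ±1 F (isSquare (- 1#)) *ℤ χ (a - b)    ∎

  ∑χ≡0 : ∑C χ ≡ + 0
  ∑χ≡0 = begin
    ∑C χ                                            ≡⟨ ∑C-cong χ≡difference ⟩
    ∑C (λ a → 𝟙 (nonzeroSquare a) +ℤ -ℤ 𝟙 (nonsquare a)) ≡⟨ ∑C-distrib-+ (𝟙 ∘ nonzeroSquare) (λ a → -ℤ 𝟙 (nonsquare a)) ⟩
    N +ℤ ∑C (λ a → -ℤ 𝟙 (nonsquare a))              ≡⟨ cong (_+ℤ_ N) (trans (∑C-neg (𝟙 ∘ nonsquare)) (cong -ℤ_ #nonsquares≡N)) ⟩
    N +ℤ -ℤ N                                       ≡⟨ ℤP.+-inverseʳ N ⟩
    + 0                                             ∎
    where
    χ≡difference : ∀ a → χ a ≡ 𝟙 (nonzeroSquare a) +ℤ -ℤ 𝟙 (nonsquare a)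
    χ≡difference a with a ≟ 0# | isSquare a in sq-a
    ... | yes _ | true = refl
    ... | yes a≡0 | false = ⊥-elim (nonsquare⇒≢0 sq-a a≡0)
    ... | no _ | true = refl
    ... | no _ | false = refl

  ∑χ[c+t]≡0 : ∀ t → ∑C (λ c → χ (c + t)) ≡ + 0
  ∑χ[c+t]≡0 t = trans (sym (∑C-reindex χ (_+ t) (_- t) (λ x → [x-y]+y≡x x t) (λ x → [x+y]-y≡x x t))) ∑χ≡0

  ∑χ[c-t]≡0 : ∀ t → ∑C (λ c → χ (c - t)) ≡ + 0
  ∑χ[c-t]≡0 t = ∑χ[c+t]≡0 (- t)

  ∑χ[t-c]≡0 : ∀ t → ∑C (λ c → χ (t - c)) ≡ + 0
  ∑χ[t-c]≡0 t = trans (sym (∑C-reindex χ (_-_ t) (_-_ t) (x-[x-y]≡y t) (x-[x-y]≡y t))) ∑χ≡0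

  J : Carrier → ℤ
  J c = ∑C (λ b → χ b *ℤ χ (b + c))

  J-0 : J 0# ≡ + q +ℤ -[1+ 0 ]
  J-0 = begin
    ∑C (λ b → χ b *ℤ χ (b + 0#))              ≡⟨ ∑C-cong (λ b → trans (cong (λ z → χ b *ℤ χ z) (+-identityʳ b)) (χ² b)) ⟩
    ∑C (λ b → 𝟙 (not (b == 0#)))              ≡⟨ ∑C-cong all-but-0 ⟩
    ∑C (λ b → + 1 +ℤ -ℤ 𝟙 (0# == b))          ≡⟨ ∑C-distrib-+ (λ _ → + 1) (λ b → -ℤ 𝟙 (0# == b)) ⟩
    ∑C (λ _ → + 1) +ℤ ∑C (λ b → -ℤ 𝟙 (0# == b)) ≡⟨ cong₂ _+ℤ_ (trans (∑C-const (+ 1)) (ℤP.*-identityʳ (+ q)))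
                                                       (trans (∑C-neg (λ b → 𝟙 (0# == b))) (cong -ℤ_ (∑C-𝟙-== 0#))) ⟩
    + q +ℤ -[1+ 0 ]                           ∎
    where
    all-but-0 : ∀ b → 𝟙 (not (b == 0#)) ≡ + 1 +ℤ -ℤ 𝟙 (0# == b)
    all-but-0 b rewrite ==-sym b 0# with 0# == b
    ... | true = refl
    ... | false = refl

  J-scale : ∀ {c} → c ≢ 0# → J c ≡ J 1#
  J-scale {c} c≢0 = begin
    J c
      ≡⟨ ∑C-reindex (λ b → χ b *ℤ χ (b + c)) (_*_ c) (_*_ (c ⁻¹)) (x*[x⁻¹*y]≡y c≢0) (x⁻¹*[x*y]≡y c≢0) ⟩
    ∑C (λ b → χ (c * b) *ℤ χ (c * b + c)) ≡⟨ ∑C-cong scale ⟩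
    J 1#                                  ∎
    where
    rearrange : ∀ x y z → (x *ℤ y) *ℤ (x *ℤ z) ≡ (x *ℤ x) *ℤ (y *ℤ z)
    rearrange = solve-∀
    scale : ∀ b → χ (c * b) *ℤ χ (c * b + c) ≡ χ b *ℤ χ (b + 1#)
    scale b = begin
      χ (c * b) *ℤ χ (c * b + c)              ≡⟨ cong₂ _*ℤ_ (χ-* c b) (trans (cong χ (x*c+x≡x*[c+1] c b)) (χ-* c (b + 1#))) ⟩
      (χ c *ℤ χ b) *ℤ (χ c *ℤ χ (b + 1#))     ≡⟨ rearrange (χ c) (χ b) (χ (b + 1#)) ⟩
      (χ c *ℤ χ c) *ℤ (χ b *ℤ χ (b + 1#))     ≡⟨ cong (_*ℤ (χ b *ℤ χ (b + 1#))) (χ²≡1 c≢0) ⟩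
      + 1 *ℤ (χ b *ℤ χ (b + 1#))              ≡⟨ ℤP.*-identityˡ _ ⟩
      χ b *ℤ χ (b + 1#)                       ∎

  ∑J≡0 : ∑C J ≡ + 0
  ∑J≡0 = begin
    ∑C (λ c → ∑C (λ b → χ b *ℤ χ (b + c)))  ≡⟨ ∑C-comm (λ c b → χ b *ℤ χ (b + c)) ⟩
    ∑C (λ b → ∑C (λ c → χ b *ℤ χ (b + c)))
      ≡⟨ ∑C-cong (λ b → trans (∑C-*ˡ (χ b) (λ c → χ (b + c))) (cong (_*ℤ_ (χ b)) (∑χ-from b))) ⟩
    ∑C (λ b → χ b *ℤ + 0)                   ≡⟨ ∑C-cong (λ b → ℤP.*-zeroʳ (χ b)) ⟩
    ∑C (λ b → + 0)                          ≡⟨ trans (∑C-const (+ 0)) (ℤP.*-zeroʳ (+ q)) ⟩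
    + 0                                     ∎
    where
    ∑χ-from : ∀ b → ∑C (λ c → χ (b + c)) ≡ + 0
    ∑χ-from b = trans (∑C-cong (λ c → cong χ (+-comm b c))) (∑χ[c+t]≡0 b)

  -- J is constant off 0 and sums to 0, so (q - 1) (J 1 + 1) = 0
  J-1 : J 1# ≡ -[1+ 0 ]
  J-1 with ℤP.i*j≡0⇒i≡0∨j≡0 (+ q +ℤ -[1+ 0 ]) {J 1# +ℤ + 1} product≡0
    where
    J-split : ∀ c → J c ≡ J 1# +ℤ 𝟙 (0# == c) *ℤ (J 0# +ℤ -ℤ J 1#)
    J-split c with 0# ≟ c
    ... | yes refl = sym (rearrange (J 1#) (J 0#))
      where
      rearrange : ∀ j₁ j₀ → j₁ +ℤ + 1 *ℤ (j₀ +ℤ -ℤ j₁) ≡ j₀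
      rearrange = solve-∀
    ... | no 0≢c = trans (J-scale (λ c≡0 → 0≢c (sym c≡0))) (sym (trans (cong (_+ℤ_ (J 1#)) (ℤP.*-zeroˡ (J 0# +ℤ -ℤ J 1#))) (ℤP.+-identityʳ (J 1#))))
    rearrange : ∀ Q j → Q *ℤ j +ℤ (Q +ℤ -[1+ 0 ] +ℤ -ℤ j) ≡ (Q +ℤ -[1+ 0 ]) *ℤ (j +ℤ + 1)
    rearrange = solve-∀
    product≡0 : (+ q +ℤ -[1+ 0 ]) *ℤ (J 1# +ℤ + 1) ≡ + 0
    product≡0 = begin
      (+ q +ℤ -[1+ 0 ]) *ℤ (J 1# +ℤ + 1)           ≡⟨ sym (rearrange (+ q) (J 1#)) ⟩
      + q *ℤ J 1# +ℤ (+ q +ℤ -[1+ 0 ] +ℤ -ℤ J 1#)  ≡⟨ cong₂ _+ℤ_ (sym (∑C-const (J 1#)))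
                                                        (cong (λ j₀ → j₀ +ℤ -ℤ J 1#) (sym J-0)) ⟩
      ∑C (λ _ → J 1#) +ℤ (J 0# +ℤ -ℤ J 1#)         ≡⟨ cong (_+ℤ_ (∑C (λ _ → J 1#)))
                                                        (sym (∑C-δ 0# (λ _ → J 0# +ℤ -ℤ J 1#))) ⟩
      ∑C (λ _ → J 1#) +ℤ ∑C (λ c → 𝟙 (0# == c) *ℤ (J 0# +ℤ -ℤ J 1#))
                                                   ≡⟨ sym (∑C-distrib-+ (λ _ → J 1#) (λ c → 𝟙 (0# == c) *ℤ (J 0# +ℤ -ℤ J 1#))) ⟩
      ∑C (λ c → J 1# +ℤ 𝟙 (0# == c) *ℤ (J 0# +ℤ -ℤ J 1#)) ≡⟨ sym (∑C-cong J-split) ⟩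
      ∑C J                                         ≡⟨ ∑J≡0 ⟩
      + 0                                          ∎
  ... | inj₁ q-1≡0 = ⊥-elim (q≢1 (ℤP.+-injective (trans (sym (undo (+ q))) (cong (_+ℤ + 1) q-1≡0))))
    where
    undo : ∀ Q → Q +ℤ -[1+ 0 ] +ℤ + 1 ≡ Q
    undo = solve-∀
  ... | inj₂ J₁+1≡0 = trans (sym (undo (J 1#))) (cong (_+ℤ -[1+ 0 ]) J₁+1≡0)
    where
    undo : ∀ j → j +ℤ + 1 +ℤ -[1+ 0 ] ≡ j
    undo = solve-∀

  jacobi : ∀ a b → ∑C (λ c → χ (c - a) *ℤ χ (c - b)) ≡ + q *ℤ 𝟙 (a == b) +ℤ -[1+ 0 ]
  jacobi a b = begin
    ∑C (λ c → χ (c - a) *ℤ χ (c - b))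
      ≡⟨ ∑C-reindex (λ c → χ (c - a) *ℤ χ (c - b)) (_+ a) (_- a) (λ x → [x-y]+y≡x x a) (λ x → [x+y]-y≡x x a) ⟩
    ∑C (λ c → χ ((c + a) - a) *ℤ χ ((c + a) - b))
      ≡⟨ ∑C-cong (λ c → cong₂ (λ u v → χ u *ℤ χ v) ([x+y]-y≡x c a) (+-assoc c a (- b))) ⟩
    J (a - b)                                    ≡⟨ by-cases (a ≟ b) ⟩
    + q *ℤ 𝟙 (a == b) +ℤ -[1+ 0 ]                ∎
    where
    by-cases : Dec (a ≡ b) → J (a - b) ≡ + q *ℤ 𝟙 (a == b) +ℤ -[1+ 0 ]
    by-cases (yes refl) rewrite ==-refl a = trans (cong J (-‿inverseʳ a)) (trans J-0 (cong (_+ℤ -[1+ 0 ]) (sym (ℤP.*-identityʳ (+ q)))))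
    by-cases (no a≢b) rewrite ≢⇒==-false a≢b =
      trans (J-scale (λ a-b≡0 → a≢b (x-y≡0⇒x≡y a b a-b≡0))) (trans J-1 (sym (cong (_+ℤ -[1+ 0 ]) (ℤP.*-zeroʳ (+ q)))))

  private
    Bool-ext : ∀ {b₁ b₂} → (b₁ ≡ true → b₂ ≡ true) → (b₂ ≡ true → b₁ ≡ true) → b₁ ≡ b₂
    Bool-ext {true} {true} _ _ = refl
    Bool-ext {false} {false} _ _ = refl
    Bool-ext {true} {false} ⇒ _ = sym (⇒ refl)
    Bool-ext {false} {true} _ ⇐ = ⇐ refl

    ==-cong : ∀ {x a y b} → (x ≡ a → y ≡ b) → (y ≡ b → x ≡ a) → (x == a) ≡ (y == b)
    ==-cong {x} {a} {y} {b} ⇒ ⇐ with x ≟ a | y ≟ b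
    ... | yes _ | yes _ = refl
    ... | no _ | no _ = refl
    ... | yes x≡a | no y≢b = ⊥-elim (y≢b (⇒ x≡a))
    ... | no x≢a | yes y≡b = ⊥-elim (x≢a (⇐ y≡b))

    q≡r+4k⇒q%4≡r : ∀ r k → r ℕ.< 4 → + q ≡ + r +ℤ (+ k +ℤ + k) +ℤ (+ k +ℤ + k) → q ℕ.% 4 ≡ r
    q≡r+4k⇒q%4≡r r k r<4 q≡r+4k = begin
      q ℕ.% 4               ≡⟨ cong (ℕ._% 4) (ℤP.+-injective (trans q≡r+4k (as-ℕ r k))) ⟩
      (r ℕ.+ k ℕ.* 4) ℕ.% 4 ≡⟨ ℕDM.[m+kn]%n≡m%n r k 4 ⟩
      r ℕ.% 4               ≡⟨ ℕDM.m<n⇒m%n≡m r<4 ⟩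
      r                     ∎
      where
      as-ℕ : ∀ r k → + r +ℤ (+ k +ℤ + k) +ℤ (+ k +ℤ + k) ≡ + (r ℕ.+ k ℕ.* 4)
      as-ℕ r k = cong +_ (four-k r k)
        where
        four-k : ∀ r k → r ℕ.+ (k ℕ.+ k) ℕ.+ (k ℕ.+ k) ≡ r ℕ.+ k ℕ.* 4
        four-k = ℕSolver.solve-∀

  nonzeroSquare-⁻¹ : ∀ x → nonzeroSquare (x ⁻¹) ≡ nonzeroSquare x
  nonzeroSquare-⁻¹ x = cong₂ (λ u v → not u ∧ v) x⁻¹==0≡x==0 sq-x⁻¹≡sq-x
    where
    x⁻¹==0≡x==0 : (x ⁻¹ == 0#) ≡ (x == 0#)
    x⁻¹==0≡x==0 = ==-cong (λ x⁻¹≡0 → trans (sym (⁻¹-involutive x)) (trans (cong _⁻¹ x⁻¹≡0) 0⁻¹≡0))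
                          (λ x≡0 → trans (cong _⁻¹ x≡0) 0⁻¹≡0)
    sq-x⁻¹≡sq-x : isSquare (x ⁻¹) ≡ isSquare x
    sq-x⁻¹≡sq-x = Bool-ext (λ sq-x⁻¹ → subst (λ z → isSquare z ≡ true) (⁻¹-involutive x) (square⇒⁻¹-square (x ⁻¹) sq-x⁻¹))
                           (square⇒⁻¹-square x)

  nonzeroSquare-neg : isSquare (- 1#) ≡ true → ∀ x → nonzeroSquare (- x) ≡ nonzeroSquare x
  nonzeroSquare-neg sq-₋₁ x = cong₂ (λ u v → not u ∧ v) -x==0≡x==0 sq-₋x≡sq-x
    where
    -x==0≡x==0 : (- x == 0#) ≡ (x == 0#)
    -x==0≡x==0 = ==-cong (λ -x≡0 → trans (sym (-‿involutive x)) (trans (cong -_ -x≡0) -0#≈0#))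
                         (λ x≡0 → trans (cong -_ x≡0) -0#≈0#)
    sq-₋x≡sq-x : isSquare (- x) ≡ isSquare x
    sq-₋x≡sq-x = Bool-ext
      (λ sq-₋x → subst (λ z → isSquare z ≡ true) (trans (-1*x≈-x (- x)) (-‿involutive x)) (square*square (- 1#) (- x) sq-₋₁ sq-₋x))
      (λ sq-x → subst (λ z → isSquare z ≡ true) (-1*x≈-x x) (square*square (- 1#) x sq-₋₁ sq-x))

  -- x ↦ -x pairs off the nonzero squares, so N is even
  -1-square⇒q%4≡1 : isSquare (- 1#) ≡ true → q ℕ.% 4 ≡ 1
  -1-square⇒q%4≡1 sq-₋₁ with ∑C-𝟙-involution -_ -‿involutive nonzeroSquare (nonzeroSquare-neg sq-₋₁) no-fixed-point
    where
    no-fixed-point : ∀ x → nonzeroSquare x ≡ true → - x ≢ x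
    no-fixed-point x nzsq-x -x≡x = proj₁ (nonzeroSquare-elim nzsq-x) (x≡-x⇒x≡0 1+1≢0 x (sym -x≡x))
  ... | k , N≡k+k = q≡r+4k⇒q%4≡r 1 k (s≤s (s≤s ℕ.z≤n)) (trans q≡1+2N (cong (λ n → + 1 +ℤ (n +ℤ n)) N≡k+k))

  private
    nonzeroSquare≢1 : Carrier → Bool
    nonzeroSquare≢1 x = nonzeroSquare x ∧ not (x == 1#)

    N≡1+#nonzeroSquare≢1 : N ≡ + 1 +ℤ ∑C (𝟙 ∘ nonzeroSquare≢1)
    N≡1+#nonzeroSquare≢1 = begin
      N                                                 ≡⟨ ∑C-cong split ⟩
      ∑C (λ x → 𝟙 (1# == x) +ℤ 𝟙 (nonzeroSquare≢1 x))   ≡⟨ ∑C-distrib-+ (λ x → 𝟙 (1# == x)) (𝟙 ∘ nonzeroSquare≢1) ⟩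
      ∑C (λ x → 𝟙 (1# == x)) +ℤ ∑C (𝟙 ∘ nonzeroSquare≢1) ≡⟨ cong (_+ℤ ∑C (𝟙 ∘ nonzeroSquare≢1)) (∑C-𝟙-== 1#) ⟩
      + 1 +ℤ ∑C (𝟙 ∘ nonzeroSquare≢1)                   ∎
      where
      1-nonzeroSquare : nonzeroSquare 1# ≡ true
      1-nonzeroSquare rewrite ≢⇒==-false {1#} {0#} (λ 1≡0 → 0≢1 (sym 1≡0)) = 1-isSquare
      split : ∀ x → 𝟙 (nonzeroSquare x) ≡ 𝟙 (1# == x) +ℤ 𝟙 (nonzeroSquare≢1 x)
      split x with 1# ≟ x
      ... | yes refl rewrite ==-refl 1# | 1-nonzeroSquare = refl
      ... | no 1≢x rewrite ≢⇒==-false (λ x≡1 → 1≢x (sym x≡1)) | ∧-identityʳ (nonzeroSquare x) = sym (ℤP.+-identityˡ _)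

  -- x ↦ x⁻¹ pairs off the nonzero squares other than 1 (a fixed point would be -1), so N is odd
  -1-nonsquare⇒q%4≡3 : isSquare (- 1#) ≡ false → q ℕ.% 4 ≡ 3
  -1-nonsquare⇒q%4≡3 ¬sq-₋₁ with ∑C-𝟙-involution _⁻¹ ⁻¹-involutive nonzeroSquare≢1 inversion-invariant no-fixed-point
    where
    1⁻¹≡1 : 1# ⁻¹ ≡ 1#
    1⁻¹≡1 = x*y≡1⇒x⁻¹≡y (*-identityˡ 1#)
    inversion-invariant : ∀ x → nonzeroSquare≢1 (x ⁻¹) ≡ nonzeroSquare≢1 x
    inversion-invariant x = cong₂ _∧_ (nonzeroSquare-⁻¹ x) (cong not (==-cong (λ x⁻¹≡1 → trans (sym (⁻¹-involutive x)) (trans (cong _⁻¹ x⁻¹≡1) 1⁻¹≡1))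
                                                                         (λ x≡1 → trans (cong _⁻¹ x≡1) 1⁻¹≡1)))
    elim : ∀ {x} → nonzeroSquare≢1 x ≡ true → x ≢ 0# × isSquare x ≡ true × x ≢ 1#
    elim {x} P-x with x ≟ 0# | isSquare x | x ≟ 1#
    ... | no x≢0 | true | no x≢1 = x≢0 , refl , x≢1
    ... | yes _ | _ | _ = ⊥-elim (true≢false (sym P-x))
    ... | no _ | false | _ = ⊥-elim (true≢false (sym P-x))
    ... | no _ | true | yes _ = ⊥-elim (true≢false (sym P-x))
    no-fixed-point : ∀ x → nonzeroSquare≢1 x ≡ true → x ⁻¹ ≢ x
    no-fixed-point x P-x x⁻¹≡x with elim P-x
    ... | x≢0 , sq-x , x≢1 with x²≡y²⇒x≡y∨x≡-y x 1# (trans (cong (_*_ x) (sym x⁻¹≡x)) (trans (x*x⁻¹≡1 x≢0) (sym (*-identityˡ 1#))))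
    ...   | inj₁ x≡1 = x≢1 x≡1
    ...   | inj₂ x≡-1 = true≢false (trans (sym sq-x) (trans (cong isSquare x≡-1) ¬sq-₋₁))
  ... | k , #nonzeroSquare≢1≡k+k = q≡r+4k⇒q%4≡r 3 k (s≤s (s≤s (s≤s (s≤s ℕ.z≤n)))) (begin
    + q                                             ≡⟨ q≡1+2N ⟩
    + 1 +ℤ (N +ℤ N)                                 ≡⟨ cong (λ n → + 1 +ℤ (n +ℤ n)) (trans N≡1+#nonzeroSquare≢1 (cong (_+ℤ_ (+ 1)) #nonzeroSquare≢1≡k+k)) ⟩
    + 1 +ℤ ((+ 1 +ℤ (+ k +ℤ + k)) +ℤ (+ 1 +ℤ (+ k +ℤ + k))) ≡⟨ regroup (+ k) ⟩
    + 3 +ℤ (+ k +ℤ + k) +ℤ (+ k +ℤ + k)             ∎)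
    where
    regroup : ∀ K → + 1 +ℤ ((+ 1 +ℤ (K +ℤ K)) +ℤ (+ 1 +ℤ (K +ℤ K))) ≡ + 3 +ℤ (K +ℤ K) +ℤ (K +ℤ K)
    regroup = solve-∀

  q%4≡1⇒-1-square : q ℕ.% 4 ≡ 1 → isSquare (- 1#) ≡ true
  q%4≡1⇒-1-square q%4≡1 with isSquare (- 1#) in sq-₋₁
  ... | true = refl
  ... | false = ⊥-elim (3≢1 (trans (sym (-1-nonsquare⇒q%4≡3 sq-₋₁)) q%4≡1))
    where
    3≢1 : 3 ≢ 1
    3≢1 ()

  q%4≡3⇒-1-nonsquare : q ℕ.% 4 ≡ 3 → isSquare (- 1#) ≡ false
  q%4≡3⇒-1-nonsquare q%4≡3 with isSquare (- 1#) in sq-₋₁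
  ... | false = refl
  ... | true = ⊥-elim (1≢3 (trans (sym (-1-square⇒q%4≡1 sq-₋₁)) q%4≡3))
    where
    1≢3 : 1 ≢ 3
    1≢3 ()

module PaleyMatrices {q : ℕ} (F : FiniteField q) (q-odd : q ℕ.% 2 ≡ 1) where

  open Field F using (Carrier; _≟_; _==_; ==-sym; ∑C; ∑C-cong; ∑C-distrib-+; ∑C-*ˡ; ∑C-neg; ∑C-const; ∑C-δ;
                      x-y≡0⇒x≡y; -‿inverseʳ; [a-c]*[b-c]≡[c-a]*[c-b])
                 renaming (_-_ to _⊖_)
  open QuadraticCharacter F q-odd using (χ; χ-0; χ-≢0; χ-*; χ[b-a]≡χ[-1]*χ[a-b]; ∑χ[c-t]≡0; ∑χ[t-c]≡0; jacobi)
  open Reduction3 using (red3-+; red3-*; red3-∑; red3-+-multiple-of-3)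
  open import Data.Integer using (_+_; _*_; -_; _-_)
  open ≡-Reasoning

  -1# : Carrier
  -1# = FiniteField.-_ F (FiniteField.1# F)

  S-just : ∀ a b → S F (just a) (just b) ≡ χ (a ⊖ b)
  S-just a b with a ≟ b
  ... | yes a≡b = sym (χ-0 (trans (cong (_⊖ b) a≡b) (-‿inverseʳ b)))
  ... | no a≢b = sym (χ-≢0 (λ a-b≡0 → a≢b (x-y≡0⇒x≡y a b a-b≡0)))

  U-just-nothing : ∀ a → U F (just a) nothing ≡ -[1+ 0 ]
  U-just-nothing a with FiniteField.isSquare F -1#
  ... | true = refl
  ... | false = refl

  Id-just : ∀ a b → Id F (just a) (just b) ≡ 𝟙 (a == b)
  Id-just a b with a ≟ b
  ... | yes refl = refl
  ... | no _ = refl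

  Id-sym : ∀ i k → Id F i k ≡ Id F k i
  Id-sym nothing nothing = refl
  Id-sym nothing (just _) = refl
  Id-sym (just _) nothing = refl
  Id-sym (just a) (just b) = trans (Id-just a b) (trans (cong 𝟙 (==-sym a b)) (sym (Id-just b a)))

  -- Sums over labels and U Uᵀ = Uᵀ U = q I

  ∑L : (Lab F → ℤ) → ℤ
  ∑L f = sumLab F _+_ (+ 0) f

  ∑L-cong : ∀ {f g : Lab F → ℤ} → (∀ l → f l ≡ g l) → ∑L f ≡ ∑L g
  ∑L-cong f≗g = cong₂ _+_ (f≗g nothing) (∑C-cong (f≗g ∘ just))

  ∑L-distrib-+ : ∀ (f g : Lab F → ℤ) → ∑L (λ l → f l + g l) ≡ ∑L f + ∑L g
  ∑L-distrib-+ f g =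
    trans (cong (_+_ (f nothing + g nothing)) (∑C-distrib-+ (f ∘ just) (g ∘ just)))
          (middle-swap (f nothing) (g nothing) _ _)
    where
    middle-swap : ∀ a b c d → (a + b) + (c + d) ≡ (a + c) + (b + d)
    middle-swap = solve-∀

  ∑L-*ˡ : ∀ c (f : Lab F → ℤ) → ∑L (λ l → c * f l) ≡ c * ∑L f
  ∑L-*ˡ c f = trans (cong (_+_ (c * f nothing)) (∑C-*ˡ c (f ∘ just))) (sym (ℤP.*-distribˡ-+ c _ _))

  ∑L-lin₃ : ∀ a b c (f g h : Lab F → ℤ) →
            ∑L (λ l → a * f l + b * g l + c * h l) ≡ a * ∑L f + b * ∑L g + c * ∑L h
  ∑L-lin₃ a b c f g h = begin
    ∑L (λ l → a * f l + b * g l + c * h l)           ≡⟨ ∑L-distrib-+ (λ l → a * f l + b * g l) (λ l → c * h l) ⟩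
    ∑L (λ l → a * f l + b * g l) + ∑L (λ l → c * h l) ≡⟨ cong₂ _+_ (∑L-distrib-+ (λ l → a * f l) (λ l → b * g l)) (∑L-*ˡ c h) ⟩
    ∑L (λ l → a * f l) + ∑L (λ l → b * g l) + c * ∑L h ≡⟨ cong (_+ c * ∑L h) (cong₂ _+_ (∑L-*ˡ a f) (∑L-*ˡ b g)) ⟩
    a * ∑L f + b * ∑L g + c * ∑L h                   ∎

  ∑L-δ : ∀ i (f : Lab F → ℤ) → ∑L (λ l → Id F i l * f l) ≡ f i
  ∑L-δ nothing f =
    trans (cong₂ _+_ (ℤP.*-identityˡ (f nothing)) (trans (∑C-const (+ 0)) (ℤP.*-zeroʳ (+ q)))) (ℤP.+-identityʳ (f nothing))
  ∑L-δ (just a) f =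
    trans (ℤP.+-identityˡ _) (trans (∑C-cong (λ c → cong (_* f (just c)) (Id-just a c))) (∑C-δ a (f ∘ just)))

  ⟨_,_⟩ : (Lab F → ℤ) → (Lab F → ℤ) → ℤ
  ⟨ f , g ⟩ = ∑L (λ l → f l * g l)

  ⟨,⟩-comm : ∀ f g → ⟨ f , g ⟩ ≡ ⟨ g , f ⟩
  ⟨,⟩-comm f g = ∑L-cong (λ l → ℤP.*-comm (f l) (g l))

  ⟨,⟩-cong : ∀ {f f′ g g′ : Lab F → ℤ} → (∀ l → f l ≡ f′ l) → (∀ l → g l ≡ g′ l) → ⟨ f , g ⟩ ≡ ⟨ f′ , g′ ⟩
  ⟨,⟩-cong f≗f′ g≗g′ = ∑L-cong (λ l → cong₂ _*_ (f≗f′ l) (g≗g′ l))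

  Uᵀ : Lab F → Lab F → ℤ
  Uᵀ i l = U F l i

  ⟨U,U⟩ : ∀ i k → ⟨ U F i , U F k ⟩ ≡ + q * Id F i k
  ⟨U,U⟩ nothing nothing = trans (ℤP.+-identityˡ _) (∑C-const (+ 1))
  ⟨U,U⟩ nothing (just b) = begin
    + 0 * U F (just b) nothing + ∑C (λ c → + 1 * S F (just b) (just c)) ≡⟨ ℤP.+-identityˡ _ ⟩
    ∑C (λ c → + 1 * S F (just b) (just c))                              ≡⟨ ∑C-cong (λ c → trans (ℤP.*-identityˡ _) (S-just b c)) ⟩
    ∑C (λ c → χ (b ⊖ c))                                                ≡⟨ ∑χ[t-c]≡0 b ⟩
    + 0                                                                 ≡⟨ sym (ℤP.*-zeroʳ (+ q)) ⟩
    + q * + 0                                                           ∎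
  ⟨U,U⟩ (just a) nothing = begin
    U F (just a) nothing * + 0 + ∑C (λ c → S F (just a) (just c) * + 1)
      ≡⟨ cong (_+ ∑C (λ c → S F (just a) (just c) * + 1)) (ℤP.*-zeroʳ (U F (just a) nothing)) ⟩
    + 0 + ∑C (λ c → S F (just a) (just c) * + 1)                        ≡⟨ ℤP.+-identityˡ _ ⟩
    ∑C (λ c → S F (just a) (just c) * + 1)                              ≡⟨ ∑C-cong (λ c → trans (ℤP.*-identityʳ _) (S-just a c)) ⟩
    ∑C (λ c → χ (a ⊖ c))                                                ≡⟨ ∑χ[t-c]≡0 a ⟩
    + 0                                                                 ≡⟨ sym (ℤP.*-zeroʳ (+ q)) ⟩
    + q * + 0                                                           ∎
  ⟨U,U⟩ (just a) (just b) = begin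
    U F (just a) nothing * U F (just b) nothing + ∑C (λ c → S F (just a) (just c) * S F (just b) (just c))
      ≡⟨ cong₂ _+_ (cong₂ _*_ (U-just-nothing a) (U-just-nothing b))
                   (∑C-cong (λ c → trans (cong₂ _*_ (S-just a c) (S-just b c)) (reflect c))) ⟩
    + 1 + ∑C (λ c → χ (c ⊖ a) * χ (c ⊖ b))   ≡⟨ cong (_+_ (+ 1)) (jacobi a b) ⟩
    + 1 + (+ q * 𝟙 (a == b) + -[1+ 0 ])      ≡⟨ cancel (+ q * 𝟙 (a == b)) ⟩
    + q * 𝟙 (a == b)                          ≡⟨ cong (_*_ (+ q)) (sym (Id-just a b)) ⟩
    + q * Id F (just a) (just b)              ∎
    where
    reflect : ∀ c → χ (a ⊖ c) * χ (b ⊖ c) ≡ χ (c ⊖ a) * χ (c ⊖ b)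
    reflect c = trans (sym (χ-* (a ⊖ c) (b ⊖ c))) (trans (cong χ ([a-c]*[b-c]≡[c-a]*[c-b] a b c)) (χ-* (c ⊖ a) (c ⊖ b)))
    cancel : ∀ x → + 1 + (x + -[1+ 0 ]) ≡ x
    cancel = solve-∀

  ⟨Uᵀ,Uᵀ⟩ : ∀ i k → ⟨ Uᵀ i , Uᵀ k ⟩ ≡ + q * Id F i k
  ⟨Uᵀ,Uᵀ⟩ nothing nothing =
    trans (ℤP.+-identityˡ _) (trans (∑C-cong (λ c → cong₂ _*_ (U-just-nothing c) (U-just-nothing c))) (∑C-const (+ 1)))
  ⟨Uᵀ,Uᵀ⟩ nothing (just b) = begin
    + 0 + ∑C (λ c → U F (just c) nothing * S F (just c) (just b))  ≡⟨ ℤP.+-identityˡ _ ⟩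
    ∑C (λ c → U F (just c) nothing * S F (just c) (just b))
      ≡⟨ ∑C-cong (λ c → trans (cong₂ _*_ (U-just-nothing c) (S-just c b)) (ℤP.-1*i≡-i (χ (c ⊖ b)))) ⟩
    ∑C (λ c → - χ (c ⊖ b))                                         ≡⟨ ∑C-neg (λ c → χ (c ⊖ b)) ⟩
    - ∑C (λ c → χ (c ⊖ b))                                         ≡⟨ cong -_ (∑χ[c-t]≡0 b) ⟩
    + 0                                                            ≡⟨ sym (ℤP.*-zeroʳ (+ q)) ⟩
    + q * + 0                                                      ∎
  ⟨Uᵀ,Uᵀ⟩ (just a) nothing = begin
    + 0 + ∑C (λ c → S F (just c) (just a) * U F (just c) nothing)  ≡⟨ ℤP.+-identityˡ _ ⟩
    ∑C (λ c → S F (just c) (just a) * U F (just c) nothing)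
      ≡⟨ ∑C-cong (λ c → trans (cong₂ _*_ (S-just c a) (U-just-nothing c)) (trans (ℤP.*-comm (χ (c ⊖ a)) -[1+ 0 ]) (ℤP.-1*i≡-i (χ (c ⊖ a))))) ⟩
    ∑C (λ c → - χ (c ⊖ a))                                         ≡⟨ ∑C-neg (λ c → χ (c ⊖ a)) ⟩
    - ∑C (λ c → χ (c ⊖ a))                                         ≡⟨ cong -_ (∑χ[c-t]≡0 a) ⟩
    + 0                                                            ≡⟨ sym (ℤP.*-zeroʳ (+ q)) ⟩
    + q * + 0                                                      ∎
  ⟨Uᵀ,Uᵀ⟩ (just a) (just b) = begin
    + 1 + ∑C (λ c → S F (just c) (just a) * S F (just c) (just b))
      ≡⟨ cong (_+_ (+ 1)) (∑C-cong (λ c → cong₂ _*_ (S-just c a) (S-just c b))) ⟩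
    + 1 + ∑C (λ c → χ (c ⊖ a) * χ (c ⊖ b))   ≡⟨ cong (_+_ (+ 1)) (jacobi a b) ⟩
    + 1 + (+ q * 𝟙 (a == b) + -[1+ 0 ])      ≡⟨ cancel (+ q * 𝟙 (a == b)) ⟩
    + q * 𝟙 (a == b)                          ≡⟨ cong (_*_ (+ q)) (sym (Id-just a b)) ⟩
    + q * Id F (just a) (just b)              ∎
    where
    cancel : ∀ x → + 1 + (x + -[1+ 0 ]) ≡ x
    cancel = solve-∀

  U² : Lab F → Lab F → ℤ
  U² i k = ⟨ U F i , Uᵀ k ⟩

  Coeffs : Set
  Coeffs = ℤ × ℤ × ℤ

  comb : Coeffs → Lab F → Lab F → ℤ
  comb (a , b , c) i l = a * Id F i l + b * U F i l + c * Uᵀ i l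

  ⟨comb,-⟩-expand : ∀ a b c i g → ⟨ comb (a , b , c) i , g ⟩ ≡ a * g i + b * ⟨ U F i , g ⟩ + c * ⟨ Uᵀ i , g ⟩
  ⟨comb,-⟩-expand a b c i g = begin
    ∑L (λ l → (a * Id F i l + b * U F i l + c * Uᵀ i l) * g l)
      ≡⟨ ∑L-cong (λ l → distribute a b c (Id F i l) (U F i l) (Uᵀ i l) (g l)) ⟩
    ∑L (λ l → a * (Id F i l * g l) + b * (U F i l * g l) + c * (Uᵀ i l * g l))
      ≡⟨ ∑L-lin₃ a b c (λ l → Id F i l * g l) (λ l → U F i l * g l) (λ l → Uᵀ i l * g l) ⟩
    a * ∑L (λ l → Id F i l * g l) + b * ⟨ U F i , g ⟩ + c * ⟨ Uᵀ i , g ⟩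
      ≡⟨ cong (λ x → a * x + b * ⟨ U F i , g ⟩ + c * ⟨ Uᵀ i , g ⟩) (∑L-δ i g) ⟩
    a * g i + b * ⟨ U F i , g ⟩ + c * ⟨ Uᵀ i , g ⟩ ∎
    where
    distribute : ∀ a b c x y z w → (a * x + b * y + c * z) * w ≡ a * (x * w) + b * (y * w) + c * (z * w)
    distribute = solve-∀

  record Gram : Set where
    constructor gram
    field
      [I] [qI] [Uᵀ] [U] [U²] [U²ᵀ] : ℤ

  ⟦_⟧ : Gram → Lab F → Lab F → ℤ
  ⟦ gram x y u v w w′ ⟧ i k = x * Id F i k + y * (+ q * Id F i k) + u * U F k i + v * U F i k + w * U² i k + w′ * U² k i

  gramOf : Coeffs → Coeffs → Gram
  gramOf (a , b , c) (a′ , b′ , c′) = gram (a * a′) (b * b′ + c * c′) (a * b′ + c * a′) (a * c′ + b * a′) (b * c′) (c * b′)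

  ⟨comb,comb⟩ : ∀ t t′ i k → ⟨ comb t i , comb t′ k ⟩ ≡ ⟦ gramOf t t′ ⟧ i k
  ⟨comb,comb⟩ t@(a , b , c) t′@(a′ , b′ , c′) i k = begin
    ⟨ comb t i , comb t′ k ⟩
      ≡⟨ ⟨comb,-⟩-expand a b c i (comb t′ k) ⟩
    a * comb t′ k i + b * ⟨ U F i , comb t′ k ⟩ + c * ⟨ Uᵀ i , comb t′ k ⟩
      ≡⟨ cong₂ (λ x y → a * comb t′ k i + b * x + c * y) (⟨-,comb⟩-expand (U F i)) (⟨-,comb⟩-expand (Uᵀ i)) ⟩
    a * comb t′ k i + b * (a′ * U F i k + b′ * ⟨ U F i , U F k ⟩ + c′ * U² i k)
                    + c * (a′ * U F k i + b′ * ⟨ Uᵀ i , U F k ⟩ + c′ * ⟨ Uᵀ i , Uᵀ k ⟩)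
      ≡⟨ cong (λ x → a * comb t′ k i + b * (a′ * U F i k + b′ * ⟨ U F i , U F k ⟩ + c′ * U² i k)
                        + c * (a′ * U F k i + b′ * x + c′ * ⟨ Uᵀ i , Uᵀ k ⟩)) (⟨,⟩-comm (Uᵀ i) (U F k)) ⟩
    a * comb t′ k i + b * (a′ * U F i k + b′ * ⟨ U F i , U F k ⟩ + c′ * U² i k)
                    + c * (a′ * U F k i + b′ * U² k i + c′ * ⟨ Uᵀ i , Uᵀ k ⟩)
      ≡⟨ cong₂ (λ x y → a * comb t′ k i + b * (a′ * U F i k + b′ * x + c′ * U² i k)
                                       + c * (a′ * U F k i + b′ * U² k i + c′ * y))
               (⟨U,U⟩ i k) (⟨Uᵀ,Uᵀ⟩ i k) ⟩
    a * (a′ * Id F k i + b′ * U F k i + c′ * U F i k) + b * (a′ * U F i k + b′ * (+ q * Id F i k) + c′ * U² i k)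
                    + c * (a′ * U F k i + b′ * U² k i + c′ * (+ q * Id F i k))
      ≡⟨ cong (λ x → a * (a′ * x + b′ * U F k i + c′ * U F i k) + b * (a′ * U F i k + b′ * (+ q * Id F i k) + c′ * U² i k)
                          + c * (a′ * U F k i + b′ * U² k i + c′ * (+ q * Id F i k))) (Id-sym k i) ⟩
    _ ≡⟨ collect a b c a′ b′ c′ (Id F i k) (+ q * Id F i k) (U F k i) (U F i k) (U² i k) (U² k i) ⟩
    ⟦ gramOf t t′ ⟧ i k ∎
    where
    ⟨-,comb⟩-expand : ∀ f → ⟨ f , comb t′ k ⟩ ≡ a′ * f k + b′ * ⟨ f , U F k ⟩ + c′ * ⟨ f , Uᵀ k ⟩
    ⟨-,comb⟩-expand f = trans (⟨,⟩-comm f (comb t′ k)) (trans (⟨comb,-⟩-expand a′ b′ c′ k f)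
                   (cong₂ (λ x y → a′ * f k + b′ * x + c′ * y) (⟨,⟩-comm (U F k) f) (⟨,⟩-comm (Uᵀ k) f)))
    collect : ∀ a b c a′ b′ c′ I qI Uki Uik W W′ →
      a * (a′ * I + b′ * Uki + c′ * Uik) + b * (a′ * Uik + b′ * qI + c′ * W) + c * (a′ * Uki + b′ * W′ + c′ * qI)
      ≡ (a * a′) * I + (b * b′ + c * c′) * qI + (a * b′ + c * a′) * Uki + (a * c′ + b * a′) * Uik + (b * c′) * W + (c * b′) * W′
    collect = solve-∀

  -- H is a Hadamard matrix

  _⊕_ : Gram → Gram → Gram
  gram x y u v w w′ ⊕ gram x′ y′ u′ v′ z z′ = gram (x + x′) (y + y′) (u + u′) (v + v′) (w + z) (w′ + z′)

  ⟦⊕⟧ : ∀ g h i k → ⟦ g ⊕ h ⟧ i k ≡ ⟦ g ⟧ i k + ⟦ h ⟧ i k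
  ⟦⊕⟧ (gram x y u v w w′) (gram x′ y′ u′ v′ z z′) i k =
    add x y u v w w′ x′ y′ u′ v′ z z′ (Id F i k) (+ q * Id F i k) (U F k i) (U F i k) (U² i k) (U² k i)
    where
    add : ∀ x y u v w w′ x′ y′ u′ v′ z z′ I qI Uki Uik W W′ →
          (x + x′) * I + (y + y′) * qI + (u + u′) * Uki + (v + v′) * Uik + (w + z) * W + (w′ + z′) * W′
          ≡ (x * I + y * qI + u * Uki + v * Uik + w * W + w′ * W′) + (x′ * I + y′ * qI + u′ * Uki + v′ * Uik + z * W + z′ * W′)
    add = solve-∀

  label : Idx F → Lab F
  label (inj₁ i) = i
  label (inj₂ i) = i

  orthogonalGram : Idx F → Idx F → Gram
  orthogonalGram (inj₁ _) (inj₁ _) = gram (+ 2) (+ 2) (+ 0) (+ 0) (+ 0) (+ 0)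
  orthogonalGram (inj₂ _) (inj₂ _) = gram (+ 2) (+ 2) (+ 0) (+ 0) (+ 0) (+ 0)
  orthogonalGram (inj₁ _) (inj₂ _) = gram (+ 0) (+ 0) (+ 0) (+ 0) (+ 0) (+ 0)
  orthogonalGram (inj₂ _) (inj₁ _) = gram (+ 0) (+ 0) (+ 0) (+ 0) (+ 0) (+ 0)

  order : ℕ
  order = 2 ℕ.* q ℕ.+ 2

  +order≡ : + order ≡ + 2 * + q + + 2
  +order≡ = trans (ℤP.pos-+ (2 ℕ.* q) 2) (cong (_+ + 2) (ℤP.pos-* 2 q))

  private
    diagonal : ∀ Q I Uki Uik W W′ →
      + 2 * I + + 2 * (Q * I) + + 0 * Uki + + 0 * Uik + + 0 * W + + 0 * W′ ≡ (+ 2 * Q + + 2) * I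
    diagonal = solve-∀
    zero-gram : ∀ Q I Uki Uik W W′ →
      + 0 * I + + 0 * (Q * I) + + 0 * Uki + + 0 * Uik + + 0 * W + + 0 * W′ ≡ + 0
    zero-gram = solve-∀

  ⟦orthogonalGram⟧ : ∀ x y → ⟦ orthogonalGram x y ⟧ (label x) (label y) ≡ + order * IdI F x y
  ⟦orthogonalGram⟧ (inj₁ i) (inj₁ k) =
    trans (diagonal (+ q) (Id F i k) (U F k i) (U F i k) (U² i k) (U² k i)) (cong₂ _*_ (sym +order≡) (sym (IdI-inj₁ i k)))
    where
    IdI-inj₁ : ∀ i k → IdI F (inj₁ i) (inj₁ k) ≡ Id F i k
    IdI-inj₁ i k with _≟L_ F i k
    ... | yes refl = refl
    ... | no _ = refl
  ⟦orthogonalGram⟧ (inj₂ i) (inj₂ k) =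
    trans (diagonal (+ q) (Id F i k) (U F k i) (U F i k) (U² i k) (U² k i)) (cong₂ _*_ (sym +order≡) (sym (IdI-inj₂ i k)))
    where
    IdI-inj₂ : ∀ i k → IdI F (inj₂ i) (inj₂ k) ≡ Id F i k
    IdI-inj₂ i k with _≟L_ F i k
    ... | yes refl = refl
    ... | no _ = refl
  ⟦orthogonalGram⟧ (inj₁ i) (inj₂ k) =
    trans (zero-gram (+ q) (Id F i k) (U F k i) (U F i k) (U² i k) (U² k i)) (sym (ℤP.*-zeroʳ (+ order)))
  ⟦orthogonalGram⟧ (inj₂ i) (inj₁ k) =
    trans (zero-gram (+ q) (Id F i k) (U F k i) (U F i k) (U² i k) (U² k i)) (sym (ℤP.*-zeroʳ (+ order)))

  gram-orthogonal : ∀ (v : Idx F → Idx F → ℤ) (κ : Idx F → Coeffs × Coeffs) →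
    (∀ x l → v x (inj₁ l) ≡ comb (proj₁ (κ x)) (label x) l) → (∀ x l → v x (inj₂ l) ≡ comb (proj₂ (κ x)) (label x) l) →
    (∀ x y → gramOf (proj₁ (κ x)) (proj₁ (κ y)) ⊕ gramOf (proj₂ (κ x)) (proj₂ (κ y)) ≡ orthogonalGram x y) →
    ∀ x y → sumIdx F _+_ (+ 0) (λ j → v x j * v y j) ≡ + order * IdI F x y
  gram-orthogonal v κ left right gram≡ x y = begin
    ⟨ v x ∘ inj₁ , v y ∘ inj₁ ⟩ + ⟨ v x ∘ inj₂ , v y ∘ inj₂ ⟩
      ≡⟨ cong₂ _+_ (⟨,⟩-cong (left x) (left y)) (⟨,⟩-cong (right x) (right y)) ⟩
    ⟨ comb (proj₁ (κ x)) (label x) , comb (proj₁ (κ y)) (label y) ⟩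
      + ⟨ comb (proj₂ (κ x)) (label x) , comb (proj₂ (κ y)) (label y) ⟩
      ≡⟨ cong₂ _+_ (⟨comb,comb⟩ (proj₁ (κ x)) (proj₁ (κ y)) (label x) (label y))
                   (⟨comb,comb⟩ (proj₂ (κ x)) (proj₂ (κ y)) (label x) (label y)) ⟩
    ⟦ gramOf (proj₁ (κ x)) (proj₁ (κ y)) ⟧ (label x) (label y) + ⟦ gramOf (proj₂ (κ x)) (proj₂ (κ y)) ⟧ (label x) (label y)
      ≡⟨ sym (⟦⊕⟧ (gramOf (proj₁ (κ x)) (proj₁ (κ y))) (gramOf (proj₂ (κ x)) (proj₂ (κ y))) (label x) (label y)) ⟩
    ⟦ gramOf (proj₁ (κ x)) (proj₁ (κ y)) ⊕ gramOf (proj₂ (κ x)) (proj₂ (κ y)) ⟧ (label x) (label y)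
      ≡⟨ cong (λ g → ⟦ g ⟧ (label x) (label y)) (gram≡ x y) ⟩
    ⟦ orthogonalGram x y ⟧ (label x) (label y)
      ≡⟨ ⟦orthogonalGram⟧ x y ⟩
    + order * IdI F x y ∎

  rowCoeffs : Idx F → Coeffs × Coeffs
  rowCoeffs (inj₁ _) = (+ 1 , + 0 , -[1+ 0 ]) , (+ 1 , + 1 , + 0)
  rowCoeffs (inj₂ _) = (+ 1 , + 0 , + 1) , (-[1+ 0 ] , + 1 , + 0)

  columnCoeffs : Idx F → Coeffs × Coeffs
  columnCoeffs (inj₁ _) = (+ 1 , -[1+ 0 ] , + 0) , (+ 1 , + 1 , + 0)
  columnCoeffs (inj₂ _) = (+ 1 , + 0 , + 1) , (-[1+ 0 ] , + 0 , + 1)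

  private
    [e-v] : ∀ e u v → e - v ≡ + 1 * e + + 0 * u + -[1+ 0 ] * v
    [e-v] = solve-∀
    [u+e] : ∀ e u v → u + e ≡ + 1 * e + + 1 * u + + 0 * v
    [u+e] = solve-∀
    [e+v] : ∀ e u v → e + v ≡ + 1 * e + + 0 * u + + 1 * v
    [e+v] = solve-∀
    [u-e] : ∀ e u v → u - e ≡ -[1+ 0 ] * e + + 1 * u + + 0 * v
    [u-e] = solve-∀
    [e-u] : ∀ e u v → e - u ≡ + 1 * e + -[1+ 0 ] * u + + 0 * v
    [e-u] = solve-∀
    [e+u] : ∀ e u v → e + u ≡ + 1 * e + + 1 * u + + 0 * v
    [e+u] = solve-∀
    [v+e] : ∀ e u v → v + e ≡ + 1 * e + + 0 * u + + 1 * v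
    [v+e] = solve-∀
    [v-e] : ∀ e u v → v - e ≡ -[1+ 0 ] * e + + 0 * u + + 1 * v
    [v-e] = solve-∀

  H-left : ∀ x l → H F x (inj₁ l) ≡ comb (proj₁ (rowCoeffs x)) (label x) l
  H-left (inj₁ i) l = [e-v] (Id F i l) (U F i l) (U F l i)
  H-left (inj₂ i) l = [e+v] (Id F i l) (U F i l) (U F l i)

  H-right : ∀ x l → H F x (inj₂ l) ≡ comb (proj₂ (rowCoeffs x)) (label x) l
  H-right (inj₁ i) l = [u+e] (Id F i l) (U F i l) (U F l i)
  H-right (inj₂ i) l = [u-e] (Id F i l) (U F i l) (U F l i)

  H-upper : ∀ y l → H F (inj₁ l) y ≡ comb (proj₁ (columnCoeffs y)) (label y) l
  H-upper (inj₁ i) l = trans (cong (_- U F i l) (Id-sym l i)) ([e-u] (Id F i l) (U F i l) (U F l i))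
  H-upper (inj₂ i) l = trans (cong (_+_ (U F l i)) (Id-sym l i)) ([v+e] (Id F i l) (U F i l) (U F l i))

  H-lower : ∀ y l → H F (inj₂ l) y ≡ comb (proj₂ (columnCoeffs y)) (label y) l
  H-lower (inj₁ i) l = trans (cong (_+ U F i l) (Id-sym l i)) ([e+u] (Id F i l) (U F i l) (U F l i))
  H-lower (inj₂ i) l = trans (cong (_-_ (U F l i)) (Id-sym l i)) ([v-e] (Id F i l) (U F i l) (U F l i))

  H-rows-orthogonal : ∀ x y → _·_ F (H F) (transpose F (H F)) x y ≡ + order * IdI F x y
  H-rows-orthogonal = gram-orthogonal (H F) rowCoeffs H-left H-right rowGram
    where
    rowGram : ∀ x y → gramOf (proj₁ (rowCoeffs x)) (proj₁ (rowCoeffs y))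
                      ⊕ gramOf (proj₂ (rowCoeffs x)) (proj₂ (rowCoeffs y)) ≡ orthogonalGram x y
    rowGram (inj₁ _) (inj₁ _) = refl
    rowGram (inj₁ _) (inj₂ _) = refl
    rowGram (inj₂ _) (inj₁ _) = refl
    rowGram (inj₂ _) (inj₂ _) = refl

  H-columns-orthogonal : ∀ x y → sumIdx F _+_ (+ 0) (λ r → H F r x * H F r y) ≡ + order * IdI F x y
  H-columns-orthogonal = gram-orthogonal (transpose F (H F)) columnCoeffs H-upper H-lower columnGram
    where
    columnGram : ∀ x y → gramOf (proj₁ (columnCoeffs x)) (proj₁ (columnCoeffs y))
                         ⊕ gramOf (proj₂ (columnCoeffs x)) (proj₂ (columnCoeffs y)) ≡ orthogonalGram x y
    columnGram (inj₁ _) (inj₁ _) = refl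
    columnGram (inj₁ _) (inj₂ _) = refl
    columnGram (inj₂ _) (inj₁ _) = refl
    columnGram (inj₂ _) (inj₂ _) = refl

  IsSign : ℤ → Set
  IsSign z = z ≡ + 1 ⊎ z ≡ -[1+ 0 ]

  hasSign : Bool → ℤ → Bool
  hasSign s h = ⌊ h ℤ.≟ ±1 F s ⌋

  private
    Id-U-pattern : ∀ i l → (Id F i l ≡ + 1 × U F i l ≡ + 0) ⊎ (Id F i l ≡ + 0 × IsSign (U F i l))
    Id-U-pattern nothing nothing = inj₁ (refl , refl)
    Id-U-pattern nothing (just b) = inj₂ (refl , inj₁ refl)
    Id-U-pattern (just a) nothing = inj₂ (refl , inj₂ (U-just-nothing a))
    Id-U-pattern (just a) (just b) with a ≟ b
    ... | yes refl = inj₁ (refl , refl)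
    ... | no _ = inj₂ (refl , ±1-sign (FiniteField.isSquare F (a ⊖ b)))
      where
      ±1-sign : ∀ s → IsSign (±1 F s)
      ±1-sign true = inj₁ refl
      ±1-sign false = inj₂ refl

    Idᵀ-U-pattern : ∀ i l → (Id F i l ≡ + 1 × U F l i ≡ + 0) ⊎ (Id F i l ≡ + 0 × IsSign (U F l i))
    Idᵀ-U-pattern i l = subst (λ e → (e ≡ + 1 × U F l i ≡ + 0) ⊎ (e ≡ + 0 × IsSign (U F l i))) (Id-sym l i) (Id-U-pattern l i)

    sign-combinations : ∀ {e u} → (e ≡ + 1 × u ≡ + 0) ⊎ (e ≡ + 0 × IsSign u) →
                        IsSign (e - u) × IsSign (u + e) × IsSign (e + u) × IsSign (u - e)
    sign-combinations (inj₁ (refl , refl)) = inj₁ refl , inj₁ refl , inj₁ refl , inj₂ refl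
    sign-combinations (inj₂ (refl , inj₁ refl)) = inj₂ refl , inj₁ refl , inj₁ refl , inj₁ refl
    sign-combinations (inj₂ (refl , inj₂ refl)) = inj₁ refl , inj₂ refl , inj₂ refl , inj₂ refl

  H-entries : ∀ x j → IsSign (H F x j)
  H-entries (inj₁ i) (inj₁ l) = proj₁ (sign-combinations (Idᵀ-U-pattern i l))
  H-entries (inj₁ i) (inj₂ l) = proj₁ (proj₂ (sign-combinations (Id-U-pattern i l)))
  H-entries (inj₂ i) (inj₁ l) = proj₁ (proj₂ (proj₂ (sign-combinations (Idᵀ-U-pattern i l))))
  H-entries (inj₂ i) (inj₂ l) = proj₂ (proj₂ (proj₂ (sign-combinations (Id-U-pattern i l))))

  H-first : ∀ j → H F (first F) j ≡ + 1
  H-first (inj₁ nothing) = refl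
  H-first (inj₁ (just b)) = cong (λ u → + 0 - u) (U-just-nothing b)
  H-first (inj₂ nothing) = refl
  H-first (inj₂ (just b)) = refl

  -- Rows and blocks of H lie in L(q)

  CodewordMod3 : (Idx F → ℤ) → Set
  CodewordMod3 v = ∀ m → red3 (v (inj₂ m)) ≡ red3 ⟨ v ∘ inj₁ , Uᵀ m ⟩

  red3-⟨,⟩ : ∀ f g → red3 ⟨ f , g ⟩ ≡ sumLab F _+₃_ zero₃ (λ l → red3 (f l) *₃ red3 (g l))
  red3-⟨,⟩ f g = begin
    red3 ⟨ f , g ⟩                                                  ≡⟨ red3-+ (f nothing * g nothing) _ ⟩
    red3 (f nothing * g nothing) +₃ red3 (∑C (λ c → f (just c) * g (just c)))
      ≡⟨ cong₂ _+₃_ (red3-* (f nothing) (g nothing)) (red3-∑ q (λ i → f (just (elem i)) * g (just (elem i)))) ⟩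
    (red3 (f nothing) *₃ red3 (g nothing)) +₃ sumFin _+₃_ zero₃ q (λ i → red3 (f (just (elem i)) * g (just (elem i))))
      ≡⟨ cong (_+₃_ (red3 (f nothing) *₃ red3 (g nothing))) (sumFin-cong q (λ i → red3-* (f (just (elem i))) (g (just (elem i))))) ⟩
    sumLab F _+₃_ zero₃ (λ l → red3 (f l) *₃ red3 (g l))            ∎
    where
    open FiniteField F using (elem)
    sumFin-cong : ∀ n {a b : Fin n → GF3} → (∀ i → a i ≡ b i) → sumFin _+₃_ zero₃ n a ≡ sumFin _+₃_ zero₃ n b
    sumFin-cong zero a≗b = refl
    sumFin-cong (suc n) a≗b = cong₂ _+₃_ (a≗b zero) (sumFin-cong n (a≗b ∘ suc))

  CodewordMod3⇒InL : ∀ v (c : Word F) → (∀ j → c j ≡ red3 (v j)) → CodewordMod3 v → InL F c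
  CodewordMod3⇒InL v c c≗v right-half = red3 ∘ v ∘ inj₁ , λ j → trans (c≗v j) (codeword j)
    where
    codeword : ∀ j → red3 (v j) ≡ sumLab F _+₃_ zero₃ (λ i → red3 (v (inj₁ i)) *₃ G′ F i j)
    codeword (inj₁ m) = sym (begin
      sumLab F _+₃_ zero₃ (λ i → red3 (v (inj₁ i)) *₃ red3 (Id F i m)) ≡⟨ sym (red3-⟨,⟩ (v ∘ inj₁) (λ i → Id F i m)) ⟩
      red3 ⟨ v ∘ inj₁ , (λ i → Id F i m) ⟩                           ≡⟨ cong red3 (trans (⟨,⟩-comm (v ∘ inj₁) (λ i → Id F i m))
                                                                             (trans (⟨,⟩-cong {g = v ∘ inj₁} (λ i → Id-sym i m) (λ _ → refl)) (∑L-δ m (v ∘ inj₁)))) ⟩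
      red3 (v (inj₁ m))                                               ∎)
    codeword (inj₂ m) = trans (right-half m) (red3-⟨,⟩ (v ∘ inj₁) (Uᵀ m))

  CodewordMod3-lincomb : ∀ α β v w → CodewordMod3 v → CodewordMod3 w → CodewordMod3 (λ j → α * (v j + β * w j))
  CodewordMod3-lincomb α β v w cv cw m = begin
    red3 (α * (v (inj₂ m) + β * w (inj₂ m)))                        ≡⟨ red3-lincomb (v (inj₂ m)) (w (inj₂ m)) ⟩
    red3 α *₃ (red3 (v (inj₂ m)) +₃ (red3 β *₃ red3 (w (inj₂ m))))
      ≡⟨ cong₂ (λ x y → red3 α *₃ (x +₃ (red3 β *₃ y))) (cv m) (cw m) ⟩
    red3 α *₃ (red3 ⟨ v ∘ inj₁ , Uᵀ m ⟩ +₃ (red3 β *₃ red3 ⟨ w ∘ inj₁ , Uᵀ m ⟩))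
      ≡⟨ sym (red3-lincomb ⟨ v ∘ inj₁ , Uᵀ m ⟩ ⟨ w ∘ inj₁ , Uᵀ m ⟩) ⟩
    red3 (α * (⟨ v ∘ inj₁ , Uᵀ m ⟩ + β * ⟨ w ∘ inj₁ , Uᵀ m ⟩))       ≡⟨ cong red3 (sym ⟨lincomb,-⟩) ⟩
    red3 ⟨ (λ l → α * (v (inj₁ l) + β * w (inj₁ l))) , Uᵀ m ⟩        ∎
    where
    red3-lincomb : ∀ a b → red3 (α * (a + β * b)) ≡ red3 α *₃ (red3 a +₃ (red3 β *₃ red3 b))
    red3-lincomb a b = trans (red3-* α (a + β * b)) (cong (_*₃_ (red3 α)) (trans (red3-+ a (β * b)) (cong (_+₃_ (red3 a)) (red3-* β b))))
    distribute : ∀ α β x y u → α * (x + β * y) * u ≡ α * (x * u) + (α * β) * (y * u)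
    distribute = solve-∀
    collect : ∀ α β x y → α * x + (α * β) * y ≡ α * (x + β * y)
    collect = solve-∀
    ⟨lincomb,-⟩ : ⟨ (λ l → α * (v (inj₁ l) + β * w (inj₁ l))) , Uᵀ m ⟩ ≡ α * (⟨ v ∘ inj₁ , Uᵀ m ⟩ + β * ⟨ w ∘ inj₁ , Uᵀ m ⟩)
    ⟨lincomb,-⟩ = begin
      ∑L (λ l → α * (v (inj₁ l) + β * w (inj₁ l)) * Uᵀ m l)
        ≡⟨ ∑L-cong (λ l → distribute α β (v (inj₁ l)) (w (inj₁ l)) (Uᵀ m l)) ⟩
      ∑L (λ l → α * (v (inj₁ l) * Uᵀ m l) + (α * β) * (w (inj₁ l) * Uᵀ m l))
        ≡⟨ ∑L-distrib-+ (λ l → α * (v (inj₁ l) * Uᵀ m l)) (λ l → (α * β) * (w (inj₁ l) * Uᵀ m l)) ⟩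
      ∑L (λ l → α * (v (inj₁ l) * Uᵀ m l)) + ∑L (λ l → (α * β) * (w (inj₁ l) * Uᵀ m l))
        ≡⟨ cong₂ _+_ (∑L-*ˡ α (λ l → v (inj₁ l) * Uᵀ m l)) (∑L-*ˡ (α * β) (λ l → w (inj₁ l) * Uᵀ m l)) ⟩
      α * ⟨ v ∘ inj₁ , Uᵀ m ⟩ + (α * β) * ⟨ w ∘ inj₁ , Uᵀ m ⟩
        ≡⟨ collect α β _ _ ⟩
      α * (⟨ v ∘ inj₁ , Uᵀ m ⟩ + β * ⟨ w ∘ inj₁ , Uᵀ m ⟩) ∎

  module _ (q%3≡2 : q ℕ.% 3 ≡ 2) where

    private
      3∣q+1 : (q ℕ.+ 1) ℕ.% 3 ≡ 0
      3∣q+1 = trans (ℕDM.%-distribˡ-+ q 1 3) (cong (λ r → (r ℕ.+ 1) ℕ.% 3) q%3≡2)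

      side : Idx F → ℤ
      side (inj₁ _) = + 1
      side (inj₂ _) = -[1+ 0 ]

      Uᵀ-as-comb : ∀ m l → Uᵀ m l ≡ comb (+ 0 , + 0 , + 1) m l
      Uᵀ-as-comb m l = only-v (Id F m l) (U F m l) (U F l m)
        where
        only-v : ∀ e u v → v ≡ + 0 * e + + 0 * u + + 1 * v
        only-v = solve-∀

      upper : ∀ Q I Umi Uim W W′ →
        + 1 * I + + 1 * Uim + + 0 * Umi
        ≡ (+ 0 * I + -[1+ 0 ] * (Q * I) + + 0 * Umi + + 1 * Uim + + 0 * W + + 0 * W′) + + 1 * ((Q + + 1) * I)
      upper = solve-∀

      lower : ∀ Q I Umi Uim W W′ →
        -[1+ 0 ] * I + + 1 * Uim + + 0 * Umi
        ≡ (+ 0 * I + + 1 * (Q * I) + + 0 * Umi + + 1 * Uim + + 0 * W + + 0 * W′) + -[1+ 0 ] * ((Q + + 1) * I)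
      lower = solve-∀

    -- (I ∓ Uᵀ) U = U ∓ q I, which agrees with U ± I up to the multiple (q + 1) I of 3
    H-right≡H-left*U : ∀ x m → H F x (inj₂ m) ≡ ⟨ H F x ∘ inj₁ , Uᵀ m ⟩ + side x * (+ (q ℕ.+ 1) * Id F (label x) m)
    H-right≡H-left*U x m = begin
      H F x (inj₂ m)                                                   ≡⟨ H-right x m ⟩
      comb (proj₂ (rowCoeffs x)) (label x) m                           ≡⟨ by-side x ⟩
      ⟦ gramOf (proj₁ (rowCoeffs x)) (+ 0 , + 0 , + 1) ⟧ (label x) m + side x * (+ (q ℕ.+ 1) * Id F (label x) m)
        ≡⟨ cong (_+ side x * (+ (q ℕ.+ 1) * Id F (label x) m)) (sym (⟨comb,comb⟩ (proj₁ (rowCoeffs x)) (+ 0 , + 0 , + 1) (label x) m)) ⟩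
      ⟨ comb (proj₁ (rowCoeffs x)) (label x) , comb (+ 0 , + 0 , + 1) m ⟩ + side x * (+ (q ℕ.+ 1) * Id F (label x) m)
        ≡⟨ cong (_+ side x * (+ (q ℕ.+ 1) * Id F (label x) m)) (sym (⟨,⟩-cong (H-left x) (Uᵀ-as-comb m))) ⟩
      ⟨ H F x ∘ inj₁ , Uᵀ m ⟩ + side x * (+ (q ℕ.+ 1) * Id F (label x) m) ∎
      where
      by-side : ∀ x → comb (proj₂ (rowCoeffs x)) (label x) m
                      ≡ ⟦ gramOf (proj₁ (rowCoeffs x)) (+ 0 , + 0 , + 1) ⟧ (label x) m + side x * (+ (q ℕ.+ 1) * Id F (label x) m)
      by-side (inj₁ i) = upper (+ q) (Id F i m) (U F m i) (U F i m) (U² i m) (U² m i)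
      by-side (inj₂ i) = lower (+ q) (Id F i m) (U F m i) (U F i m) (U² i m) (U² m i)

    H-row-CodewordMod3 : ∀ x → CodewordMod3 (H F x)
    H-row-CodewordMod3 x m =
      trans (cong red3 (H-right≡H-left*U x m))
            (red3-+-multiple-of-3 ⟨ H F x ∘ inj₁ , Uᵀ m ⟩ (side x) (q ℕ.+ 1) (Id F (label x) m) 3∣q+1)

    H-rows-in-L : ∀ x → InL F (rowGF3 F (H F) x)
    H-rows-in-L x = CodewordMod3⇒InL (H F x) (rowGF3 F (H F) x) (λ _ → refl) (H-row-CodewordMod3 x)

    blockWord-mod3 : ∀ r s j → blockWord F (H F) r s j ≡ red3 (+ 2 * (H F (first F) j + ±1 F s * H F r j))
    blockWord-mod3 r s j =
      trans (by-cases s (H-entries r j)) (cong (λ h₀ → red3 (+ 2 * (h₀ + ±1 F s * H F r j))) (sym (H-first j)))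
      where
      by-cases : ∀ s {h} → IsSign h → (if hasSign s h then one₃ else zero₃) ≡ red3 (+ 2 * (+ 1 + ±1 F s * h))
      by-cases true (inj₁ refl) = refl
      by-cases true (inj₂ refl) = refl
      by-cases false (inj₁ refl) = refl
      by-cases false (inj₂ refl) = refl

    blocks-in-L : ∀ r s → InL F (blockWord F (H F) r s)
    blocks-in-L r s =
      CodewordMod3⇒InL (λ j → + 2 * (H F (first F) j + ±1 F s * H F r j)) (blockWord F (H F) r s) (blockWord-mod3 r s)
        (CodewordMod3-lincomb (+ 2) (±1 F s) (H F (first F)) (H F r) (H-row-CodewordMod3 (first F)) (H-row-CodewordMod3 r))

  -- The Hadamard 3-design

  IdI-inj₁ : ∀ i k → IdI F (inj₁ i) (inj₁ k) ≡ Id F i k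
  IdI-inj₁ i k with _≟L_ F i k
  ... | yes refl = refl
  ... | no _ = refl

  IdI-inj₂ : ∀ i k → IdI F (inj₂ i) (inj₂ k) ≡ Id F i k
  IdI-inj₂ i k with _≟L_ F i k
  ... | yes refl = refl
  ... | no _ = refl

  IdI-refl : ∀ x → IdI F x x ≡ + 1
  IdI-refl x with _≟I_ F x x
  ... | yes _ = refl
  ... | no x≢x = ⊥-elim (x≢x refl)

  IdI-≢ : ∀ {x y} → x ≢ y → IdI F x y ≡ + 0
  IdI-≢ {x} {y} x≢y with _≟I_ F x y
  ... | yes x≡y = ⊥-elim (x≢y x≡y)
  ... | no _ = refl

  ∑I : (Idx F → ℤ) → ℤ
  ∑I f = sumIdx F _+_ (+ 0) f

  ∑I-cong : ∀ {f g : Idx F → ℤ} → (∀ j → f j ≡ g j) → ∑I f ≡ ∑I g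
  ∑I-cong f≗g = cong₂ _+_ (∑L-cong (f≗g ∘ inj₁)) (∑L-cong (f≗g ∘ inj₂))

  ∑I-distrib-+ : ∀ (f g : Idx F → ℤ) → ∑I (λ j → f j + g j) ≡ ∑I f + ∑I g
  ∑I-distrib-+ f g =
    trans (cong₂ _+_ (∑L-distrib-+ (f ∘ inj₁) (g ∘ inj₁)) (∑L-distrib-+ (f ∘ inj₂) (g ∘ inj₂)))
          (middle-swap (∑L (f ∘ inj₁)) (∑L (g ∘ inj₁)) (∑L (f ∘ inj₂)) (∑L (g ∘ inj₂)))
    where
    middle-swap : ∀ a b c d → (a + b) + (c + d) ≡ (a + c) + (b + d)
    middle-swap = solve-∀

  ∑I-*ˡ : ∀ c (f : Idx F → ℤ) → ∑I (λ j → c * f j) ≡ c * ∑I f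
  ∑I-*ˡ c f = trans (cong₂ _+_ (∑L-*ˡ c (f ∘ inj₁)) (∑L-*ˡ c (f ∘ inj₂))) (sym (ℤP.*-distribˡ-+ c _ _))

  ∑I-const : ∀ c → ∑I (λ _ → c) ≡ + order * c
  ∑I-const c = begin
    (c + ∑C (λ _ → c)) + (c + ∑C (λ _ → c)) ≡⟨ cong (λ s → (c + s) + (c + s)) (∑C-const c) ⟩
    (c + + q * c) + (c + + q * c)           ≡⟨ twice (+ q) c ⟩
    (+ 2 * + q + + 2) * c                   ≡⟨ cong (_* c) (sym +order≡) ⟩
    + order * c                   ∎
    where
    twice : ∀ Q c → (c + Q * c) + (c + Q * c) ≡ (+ 2 * Q + + 2) * c
    twice = solve-∀

  ∑I-δ : ∀ x (f : Idx F → ℤ) → ∑I (λ j → IdI F x j * f j) ≡ f x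
  ∑I-δ (inj₁ i) f = begin
    ∑L (λ l → IdI F (inj₁ i) (inj₁ l) * f (inj₁ l)) + ∑L (λ l → + 0 * f (inj₂ l))
      ≡⟨ cong₂ _+_ (∑L-cong (λ l → cong (_* f (inj₁ l)) (IdI-inj₁ i l))) (trans (∑L-*ˡ (+ 0) (f ∘ inj₂)) (ℤP.*-zeroˡ (∑L (f ∘ inj₂)))) ⟩
    ∑L (λ l → Id F i l * f (inj₁ l)) + + 0 ≡⟨ ℤP.+-identityʳ _ ⟩
    ∑L (λ l → Id F i l * f (inj₁ l))       ≡⟨ ∑L-δ i (f ∘ inj₁) ⟩
    f (inj₁ i)                             ∎
  ∑I-δ (inj₂ i) f = begin
    ∑L (λ l → + 0 * f (inj₁ l)) + ∑L (λ l → IdI F (inj₂ i) (inj₂ l) * f (inj₂ l))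
      ≡⟨ cong₂ _+_ (trans (∑L-*ˡ (+ 0) (f ∘ inj₁)) (ℤP.*-zeroˡ (∑L (f ∘ inj₁)))) (∑L-cong (λ l → cong (_* f (inj₂ l)) (IdI-inj₂ i l))) ⟩
    + 0 + ∑L (λ l → Id F i l * f (inj₂ l)) ≡⟨ ℤP.+-identityˡ _ ⟩
    ∑L (λ l → Id F i l * f (inj₂ l))       ≡⟨ ∑L-δ i (f ∘ inj₂) ⟩
    f (inj₂ i)                             ∎

  count≡∑I : ∀ (P : Idx F → Bool) → + countIdx F P ≡ ∑I (𝟙 ∘ P)
  count≡∑I P = trans (ℤP.pos-+ (#labels (P ∘ inj₁)) (#labels (P ∘ inj₂))) (cong₂ _+_ (labels (P ∘ inj₁)) (labels (P ∘ inj₂)))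
    where
    open FiniteField F using (elem)
    𝟙≡ : ∀ b → + (if b then 1 else 0) ≡ 𝟙 b
    𝟙≡ true = refl
    𝟙≡ false = refl
    #labels : (Lab F → Bool) → ℕ
    #labels P = sumLab F ℕ._+_ 0 (λ l → if P l then 1 else 0)
    labels : ∀ (P : Lab F → Bool) → + #labels P ≡ ∑L (𝟙 ∘ P)
    labels P = trans (ℤP.pos-+ (if P nothing then 1 else 0) _) (cong₂ _+_ (𝟙≡ (P nothing))
                 (trans (sym (∑-pos q (λ i → if P (just (elem i)) then 1 else 0))) (∑C-cong (𝟙≡ ∘ P ∘ just))))

  sign² : ∀ {h} → IsSign h → h * h ≡ + 1
  sign² (inj₁ refl) = refl
  sign² (inj₂ refl) = refl

  H-row-sum : ∀ r → r ≢ first F → ∑I (H F r) ≡ + 0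
  H-row-sum r r≢first = begin
    ∑I (H F r)
      ≡⟨ ∑I-cong (λ j → sym (trans (cong (_*_ (H F r j)) (H-first j)) (ℤP.*-identityʳ (H F r j)))) ⟩
    ∑I (λ j → H F r j * H F (first F) j)        ≡⟨ H-rows-orthogonal r (first F) ⟩
    + order * IdI F r (first F)       ≡⟨ cong (_*_ (+ order)) (IdI-≢ r≢first) ⟩
    + order * + 0                     ≡⟨ ℤP.*-zeroʳ (+ order) ⟩
    + 0                                         ∎

  inBlock-indicator : ∀ s {h} → IsSign h → + 2 * 𝟙 (hasSign s h) ≡ + 1 + ±1 F s * h
  inBlock-indicator true (inj₁ refl) = refl
  inBlock-indicator true (inj₂ refl) = refl
  inBlock-indicator false (inj₁ refl) = refl
  inBlock-indicator false (inj₂ refl) = refl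

  block-weight : ∀ r s → r ≢ first F → weight F (blockWord F (H F) r s) ≡ q ℕ.+ 1
  block-weight r s r≢first = ℕP.*-cancelˡ-≡ _ _ 2 (ℤP.+-injective (begin
    + (2 ℕ.* w)                                  ≡⟨ ℤP.pos-* 2 w ⟩
    + 2 * + w
      ≡⟨ cong (_*_ (+ 2)) (trans (count≡∑I nonzero) (∑I-cong (λ j → cong 𝟙 (nonzero≡inBlock j)))) ⟩
    + 2 * ∑I (𝟙 ∘ inB)                           ≡⟨ sym (∑I-*ˡ (+ 2) (𝟙 ∘ inB)) ⟩
    ∑I (λ j → + 2 * 𝟙 (inB j))                   ≡⟨ ∑I-cong (λ j → inBlock-indicator s (H-entries r j)) ⟩
    ∑I (λ j → + 1 + ±1 F s * H F r j)            ≡⟨ ∑I-distrib-+ (λ _ → + 1) (λ j → ±1 F s * H F r j) ⟩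
    ∑I (λ _ → + 1) + ∑I (λ j → ±1 F s * H F r j)
      ≡⟨ cong₂ _+_ (∑I-const (+ 1)) (trans (∑I-*ˡ (±1 F s) (H F r)) (cong (_*_ (±1 F s)) (H-row-sum r r≢first))) ⟩
    + order * + 1 + ±1 F s * + 0       ≡⟨ cong₂ _+_ (ℤP.*-identityʳ (+ order)) (ℤP.*-zeroʳ (±1 F s)) ⟩
    + order + + 0                      ≡⟨ cong +_ (trans (ℕP.+-identityʳ _) (sym (ℕP.*-distribˡ-+ 2 q 1))) ⟩
    + (2 ℕ.* (q ℕ.+ 1))                          ∎))
    where
    w : ℕ
    w = weight F (blockWord F (H F) r s)
    inB nonzero : Idx F → Bool
    inB = inBlock F (H F) r s
    nonzero j = if ⌊ blockWord F (H F) r s j Fin.≟ zero₃ ⌋ then false else true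
    nonzero≡inBlock : ∀ j → nonzero j ≡ inB j
    nonzero≡inBlock j with inB j
    ... | true = refl
    ... | false = refl

  sign-* : ∀ {h k} → IsSign h → IsSign k → IsSign (h * k)
  sign-* (inj₁ refl) (inj₁ refl) = inj₁ refl
  sign-* (inj₁ refl) (inj₂ refl) = inj₂ refl
  sign-* (inj₂ refl) (inj₁ refl) = inj₂ refl
  sign-* (inj₂ refl) (inj₂ refl) = inj₁ refl

  ±1-sign : ∀ s → IsSign (±1 F s)
  ±1-sign true = inj₁ refl
  ±1-sign false = inj₂ refl

  ±1-cancelʳ : ∀ s s′ {h} → IsSign h → ±1 F s * h ≡ ±1 F s′ * h → s ≡ s′
  ±1-cancelʳ true true _ _ = refl
  ±1-cancelʳ false false _ _ = refl
  ±1-cancelʳ true false (inj₁ refl) ()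
  ±1-cancelʳ true false (inj₂ refl) ()
  ±1-cancelʳ false true (inj₁ refl) ()
  ±1-cancelʳ false true (inj₂ refl) ()

  same-blockWord⇒same-signed-row : ∀ r r′ s s′ → (∀ j → blockWord F (H F) r s j ≡ blockWord F (H F) r′ s′ j) →
                                   ∀ j → ±1 F s * H F r j ≡ ±1 F s′ * H F r′ j
  same-blockWord⇒same-signed-row r r′ s s′ same-word j = +ℤ-cancelˡ (+ 1) (begin
    + 1 + ±1 F s * H F r j                   ≡⟨ sym (inBlock-indicator s (H-entries r j)) ⟩
    + 2 * 𝟙 (inBlock F (H F) r s j)          ≡⟨ cong (λ b → + 2 * 𝟙 b) (indicator-injective _ _ (same-word j)) ⟩
    + 2 * 𝟙 (inBlock F (H F) r′ s′ j)        ≡⟨ inBlock-indicator s′ (H-entries r′ j) ⟩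
    + 1 + ±1 F s′ * H F r′ j                 ∎)
    where
    indicator-injective : ∀ b b′ → (if b then one₃ else zero₃) ≡ (if b′ then one₃ else zero₃) → b ≡ b′
    indicator-injective true true _ = refl
    indicator-injective false false _ = refl
    indicator-injective true false ()
    indicator-injective false true ()

  signed-rows-equal⇒same-row : ∀ r r′ {a b} → IsSign a → IsSign b → (∀ j → a * H F r j ≡ b * H F r′ j) → r ≡ r′
  signed-rows-equal⇒same-row r r′ {a} {b} a-sign b-sign same-row with _≟I_ F r r′
  ... | yes r≡r′ = r≡r′
  ... | no r≢r′ = ⊥-elim (order≢0 (begin
    + order                                       ≡⟨ sym (trans (∑I-const (+ 1)) (ℤP.*-identityʳ (+ order))) ⟩
    ∑I (λ _ → + 1)                                ≡⟨ ∑I-cong entry ⟩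
    ∑I (λ j → (a * b) * (H F r j * H F r′ j))     ≡⟨ ∑I-*ˡ (a * b) (λ j → H F r j * H F r′ j) ⟩
    (a * b) * ∑I (λ j → H F r j * H F r′ j)       ≡⟨ cong (_*_ (a * b)) (H-rows-orthogonal r r′) ⟩
    (a * b) * (+ order * IdI F r r′)              ≡⟨ cong (λ e → (a * b) * (+ order * e)) (IdI-≢ r≢r′) ⟩
    (a * b) * (+ order * + 0)                     ≡⟨ cong (_*_ (a * b)) (ℤP.*-zeroʳ (+ order)) ⟩
    (a * b) * + 0                                 ≡⟨ ℤP.*-zeroʳ (a * b) ⟩
    + 0                                           ∎))
    where
    order≢0 : + order ≢ + 0
    order≢0 eq with ℕP.m+n≡0⇒n≡0 (2 ℕ.* q) (ℤP.+-injective eq)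
    ... | ()
    rearrange : ∀ a b h k → (a * h) * (b * k) ≡ (a * b) * (h * k)
    rearrange = solve-∀
    entry : ∀ j → + 1 ≡ (a * b) * (H F r j * H F r′ j)
    entry j = begin
      + 1                                ≡⟨ sym (sign² (sign-* a-sign (H-entries r j))) ⟩
      (a * H F r j) * (a * H F r j)      ≡⟨ cong (_*_ (a * H F r j)) (same-row j) ⟩
      (a * H F r j) * (b * H F r′ j)     ≡⟨ rearrange a b (H F r j) (H F r′ j) ⟩
      (a * b) * (H F r j * H F r′ j)     ∎

  blocks-distinct : ∀ r r′ s s′ → (∀ j → blockWord F (H F) r s j ≡ blockWord F (H F) r′ s′ j) → r ≡ r′ × s ≡ s′
  blocks-distinct r r′ s s′ same-word = r≡r′ , ±1-cancelʳ s s′ (H-entries r (first F)) same-entry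
    where
    same-signed-row : ∀ j → ±1 F s * H F r j ≡ ±1 F s′ * H F r′ j
    same-signed-row = same-blockWord⇒same-signed-row r r′ s s′ same-word
    r≡r′ : r ≡ r′
    r≡r′ = signed-rows-equal⇒same-row r r′ (±1-sign s) (±1-sign s′) same-signed-row
    same-entry : ±1 F s * H F r (first F) ≡ ±1 F s′ * H F r (first F)
    same-entry = trans (same-signed-row (first F)) (cong (λ x → ±1 F s′ * H F x (first F)) (sym r≡r′))

  monochromatic-indicator : ∀ {hx hy hz} → IsSign hx → IsSign hy → IsSign hz →
    + 4 * (𝟙 (hasSign true hx ∧ hasSign true hy ∧ hasSign true hz) + 𝟙 (hasSign false hx ∧ hasSign false hy ∧ hasSign false hz))
    ≡ + 1 + (hx * hy + hy * hz + hx * hz)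
  monochromatic-indicator (inj₁ refl) (inj₁ refl) (inj₁ refl) = refl
  monochromatic-indicator (inj₁ refl) (inj₁ refl) (inj₂ refl) = refl
  monochromatic-indicator (inj₁ refl) (inj₂ refl) (inj₁ refl) = refl
  monochromatic-indicator (inj₁ refl) (inj₂ refl) (inj₂ refl) = refl
  monochromatic-indicator (inj₂ refl) (inj₁ refl) (inj₁ refl) = refl
  monochromatic-indicator (inj₂ refl) (inj₁ refl) (inj₂ refl) = refl
  monochromatic-indicator (inj₂ refl) (inj₂ refl) (inj₁ refl) = refl
  monochromatic-indicator (inj₂ refl) (inj₂ refl) (inj₂ refl) = refl

  H-columns-orthogonal-≢ : ∀ {u v} → u ≢ v → ∑I (λ r → H F r u * H F r v) ≡ + 0
  H-columns-orthogonal-≢ {u} {v} u≢v =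
    trans (H-columns-orthogonal u v) (trans (cong (_*_ (+ order)) (IdI-≢ u≢v)) (ℤP.*-zeroʳ (+ order)))

  ∑-pairwise-column-products : ∀ {x y z} → x ≢ y → y ≢ z → x ≢ z →
    ∑I (λ r → + 1 + (H F r x * H F r y + H F r y * H F r z + H F r x * H F r z)) ≡ + order
  ∑-pairwise-column-products {x} {y} {z} x≢y y≢z x≢z = begin
    ∑I (λ r → + 1 + (hxy r + hyz r + hxz r))
      ≡⟨ ∑I-distrib-+ (λ _ → + 1) (λ r → hxy r + hyz r + hxz r) ⟩
    ∑I (λ _ → + 1) + ∑I (λ r → hxy r + hyz r + hxz r)
      ≡⟨ cong (_+_ (∑I (λ _ → + 1))) (trans (∑I-distrib-+ (λ r → hxy r + hyz r) hxz) (cong (_+ ∑I hxz) (∑I-distrib-+ hxy hyz))) ⟩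
    ∑I (λ _ → + 1) + (∑I hxy + ∑I hyz + ∑I hxz)
      ≡⟨ cong₂ _+_ (trans (∑I-const (+ 1)) (ℤP.*-identityʳ (+ order)))
                   (cong₂ _+_ (cong₂ _+_ (H-columns-orthogonal-≢ x≢y) (H-columns-orthogonal-≢ y≢z)) (H-columns-orthogonal-≢ x≢z)) ⟩
    + order + + 0                            ≡⟨ ℤP.+-identityʳ (+ order) ⟩
    + order                                  ∎
    where
    hxy hyz hxz : Idx F → ℤ
    hxy r = H F r x * H F r y
    hyz r = H F r y * H F r z
    hxz r = H F r x * H F r z

  4λ+4≡order : ∀ x y z → x ≢ y → y ≢ z → x ≢ z → 4 ℕ.* countBlocks3 F (H F) x y z ℕ.+ 4 ≡ order
  4λ+4≡order x y z x≢y y≢z x≢z = ℤP.+-injective (begin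
    + (4 ℕ.* λ′ ℕ.+ 4)                       ≡⟨ trans (ℤP.pos-+ (4 ℕ.* λ′) 4) (cong (_+ + 4) (ℤP.pos-* 4 λ′)) ⟩
    + 4 * + λ′ + + 4                         ≡⟨ cong₂ (λ c t → + 4 * c + t) λ-as-sum (sym (∑I-δ (first F) (λ _ → + 4))) ⟩
    + 4 * (∑I (𝟙 ∘ contains true) + ∑I (𝟙 ∘ contains false)) + ∑I (λ r → IdI F (first F) r * + 4)
      ≡⟨ cong (λ t → + 4 * t + ∑I (λ r → IdI F (first F) r * + 4)) (sym (∑I-distrib-+ (𝟙 ∘ contains true) (𝟙 ∘ contains false))) ⟩
    + 4 * ∑I (λ r → 𝟙 (contains true r) + 𝟙 (contains false r)) + ∑I (λ r → IdI F (first F) r * + 4)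
      ≡⟨ cong (_+ ∑I (λ r → IdI F (first F) r * + 4)) (sym (∑I-*ˡ (+ 4) (λ r → 𝟙 (contains true r) + 𝟙 (contains false r)))) ⟩
    ∑I (λ r → + 4 * (𝟙 (contains true r) + 𝟙 (contains false r))) + ∑I (λ r → IdI F (first F) r * + 4)
      ≡⟨ sym (∑I-distrib-+ (λ r → + 4 * (𝟙 (contains true r) + 𝟙 (contains false r))) (λ r → IdI F (first F) r * + 4)) ⟩
    ∑I (λ r → + 4 * (𝟙 (contains true r) + 𝟙 (contains false r)) + IdI F (first F) r * + 4)
      ≡⟨ ∑I-cong per-row ⟩
    ∑I (λ r → + 1 + (H F r x * H F r y + H F r y * H F r z + H F r x * H F r z))
      ≡⟨ ∑-pairwise-column-products x≢y y≢z x≢z ⟩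
    + order                                  ∎)
    where
    λ′ : ℕ
    λ′ = countBlocks3 F (H F) x y z
    contains : Bool → Idx F → Bool
    contains s r = if ⌊ _≟I_ F r (first F) ⌋ then false else (inBlock F (H F) r s x ∧ inBlock F (H F) r s y ∧ inBlock F (H F) r s z)
    λ-as-sum : + λ′ ≡ ∑I (𝟙 ∘ contains true) + ∑I (𝟙 ∘ contains false)
    λ-as-sum = trans (ℤP.pos-+ (countIdx F (contains true)) (countIdx F (contains false)))
                     (cong₂ _+_ (count≡∑I (contains true)) (count≡∑I (contains false)))
    per-row : ∀ r → + 4 * (𝟙 (contains true r) + 𝟙 (contains false r)) + IdI F (first F) r * + 4
                    ≡ + 1 + (H F r x * H F r y + H F r y * H F r z + H F r x * H F r z)
    per-row r with _≟I_ F r (first F)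
    ... | yes refl rewrite IdI-refl (first F) | H-first x | H-first y | H-first z = refl
    ... | no r≢first rewrite IdI-≢ (λ first≡r → r≢first (sym first≡r)) =
      trans (ℤP.+-identityʳ _) (monochromatic-indicator (H-entries r x) (H-entries r y) (H-entries r z))

  H-3-design : ∀ x y z → x ≢ y → y ≢ z → x ≢ z → countBlocks3 F (H F) x y z ≡ (q ℕ.∸ 1) ℕ./ 2
  H-3-design x y z x≢y y≢z x≢z = trans λ≡m (sym (trans (cong (λ n → (n ℕ.∸ 1) ℕ./ 2) q≡1+2m) (ℕDM.m*n/n≡m m 2)))
    where
    m : ℕ
    m = q ℕ./ 2
    q≡1+2m : q ≡ 1 ℕ.+ m ℕ.* 2
    q≡1+2m = trans (ℕDM.m≡m%n+[m/n]*n q 2) (cong (ℕ._+ m ℕ.* 2) q-odd)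
    regroup : ∀ m → 2 ℕ.* (1 ℕ.+ m ℕ.* 2) ℕ.+ 2 ≡ 4 ℕ.* m ℕ.+ 4
    regroup = ℕSolver.solve-∀
    λ≡m : countBlocks3 F (H F) x y z ≡ m
    λ≡m = ℕP.*-cancelˡ-≡ _ m 4 (ℕP.+-cancelʳ-≡ 4 _ (4 ℕ.* m)
            (trans (4λ+4≡order x y z x≢y y≢z x≢z) (trans (cong (λ n → 2 ℕ.* n ℕ.+ 2) q≡1+2m) (regroup m))))

  -- Equivalence with the Paley–Hadamard matrices of type II

  signedPermutation : (Idx F → Idx F) → (Idx F → ℤ) → Mat F
  signedPermutation π σ r r′ = σ r * IdI F (π r) r′

  private
    IdI-sym : ∀ x y → IdI F x y ≡ IdI F y x
    IdI-sym x y with _≟I_ F x y | _≟I_ F y x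
    ... | yes _ | yes _ = refl
    ... | no _ | no _ = refl
    ... | yes x≡y | no y≢x = ⊥-elim (y≢x (sym x≡y))
    ... | no x≢y | yes y≡x = ⊥-elim (x≢y (sym y≡x))

    IdI≢0 : ∀ {x y} → IdI F x y ≢ + 0 → y ≡ x
    IdI≢0 {x} {y} IdI≢0 with _≟I_ F x y
    ... | yes x≡y = sym x≡y
    ... | no _ = ⊥-elim (IdI≢0 refl)

    sign≢0 : ∀ {z} → IsSign z → z ≢ + 0
    sign≢0 (inj₁ refl) ()
    sign≢0 (inj₂ refl) ()

    right-factor≢0 : ∀ a {b} → a * b ≢ + 0 → b ≢ + 0
    right-factor≢0 a ab≢0 b≡0 = ab≢0 (trans (cong (_*_ a) b≡0) (ℤP.*-zeroʳ a))

  signedPermutation-monomial : ∀ π → (∀ x → π (π x) ≡ x) → ∀ σ → (∀ x → IsSign (σ x)) →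
                               IsMonomial F (signedPermutation π σ)
  signedPermutation-monomial π ππ≡id σ σ-signs = entries , rows , columns
    where
    entries : ∀ i j → let e = signedPermutation π σ i j in (e ≡ + 0) ⊎ (e ≡ + 1) ⊎ (e ≡ -[1+ 0 ])
    entries i j with _≟I_ F (π i) j | σ-signs i
    ... | no _ | _ = inj₁ (ℤP.*-zeroʳ (σ i))
    ... | yes _ | inj₁ σi≡1 = inj₂ (inj₁ (trans (ℤP.*-identityʳ (σ i)) σi≡1))
    ... | yes _ | inj₂ σi≡-1 = inj₂ (inj₂ (trans (ℤP.*-identityʳ (σ i)) σi≡-1))
    on-diagonal : ∀ i → signedPermutation π σ i (π i) ≢ + 0
    on-diagonal i = subst (λ e → σ i * e ≢ + 0) (sym (IdI-refl (π i)))
                          (λ σi*1≡0 → sign≢0 (σ-signs i) (trans (sym (ℤP.*-identityʳ (σ i))) σi*1≡0))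
    rows : ∀ i → ∃[ j ] (signedPermutation π σ i j ≢ + 0 × (∀ j′ → signedPermutation π σ i j′ ≢ + 0 → j′ ≡ j))
    rows i = π i , on-diagonal i , λ j′ entry≢0 → IdI≢0 (right-factor≢0 (σ i) entry≢0)
    columns : ∀ j → ∃[ i ] (signedPermutation π σ i j ≢ + 0 × (∀ i′ → signedPermutation π σ i′ j ≢ + 0 → i′ ≡ i))
    columns j = π j , subst (λ x → signedPermutation π σ (π j) x ≢ + 0) (ππ≡id j) (on-diagonal (π j)) ,
                λ i′ entry≢0 → trans (sym (ππ≡id i′)) (cong π (sym (IdI≢0 (right-factor≢0 (σ i′) entry≢0))))

  signedPermutation-sandwich : ∀ (X : Mat F) π σ ρ r j →
    _·_ F (_·_ F (signedPermutation π σ) X) (signedPermutation id ρ) r j ≡ σ r * X (π r) j * ρ j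
  signedPermutation-sandwich X π σ ρ r j = begin
    ∑I (λ k → ∑I (λ r′ → (σ r * IdI F (π r) r′) * X r′ k) * (ρ k * IdI F k j))
      ≡⟨ ∑I-cong (λ k → cong (_* (ρ k * IdI F k j)) (select-row k)) ⟩
    ∑I (λ k → (σ r * X (π r) k) * (ρ k * IdI F k j))
      ≡⟨ ∑I-cong (λ k → trans (rearrange (σ r) (X (π r) k) (ρ k) (IdI F k j)) (cong (_* (σ r * X (π r) k * ρ k)) (IdI-sym k j))) ⟩
    ∑I (λ k → IdI F j k * (σ r * X (π r) k * ρ k))
      ≡⟨ ∑I-δ j (λ k → σ r * X (π r) k * ρ k) ⟩
    σ r * X (π r) j * ρ j ∎
    where
    rearrange : ∀ s x p e → (s * x) * (p * e) ≡ e * (s * x * p)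
    rearrange = solve-∀
    select-row : ∀ k → ∑I (λ r′ → (σ r * IdI F (π r) r′) * X r′ k) ≡ σ r * X (π r) k
    select-row k = begin
      ∑I (λ r′ → (σ r * IdI F (π r) r′) * X r′ k)  ≡⟨ ∑I-cong (λ r′ → ℤP.*-assoc (σ r) (IdI F (π r) r′) (X r′ k)) ⟩
      ∑I (λ r′ → σ r * (IdI F (π r) r′ * X r′ k))  ≡⟨ ∑I-*ˡ (σ r) (λ r′ → IdI F (π r) r′ * X r′ k) ⟩
      σ r * ∑I (λ r′ → IdI F (π r) r′ * X r′ k)    ≡⟨ cong (_*_ (σ r)) (∑I-δ (π r) (λ r′ → X r′ k)) ⟩
      σ r * X (π r) k                              ∎

  S-transpose : ∀ a b → S F (just b) (just a) ≡ ±1 F (FiniteField.isSquare F -1#) * S F (just a) (just b)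
  S-transpose a b = trans (S-just b a) (trans (χ[b-a]≡χ[-1]*χ[a-b] a b) (cong (_*_ (±1 F (FiniteField.isSquare F -1#))) (sym (S-just a b))))

  module _ (-1-nonsquare : FiniteField.isSquare F -1# ≡ false) where

    private
      U≡S : ∀ i l → U F i l ≡ S F i l
      U≡S nothing nothing = refl
      U≡S (just a) nothing = trans (U-just-nothing a) (sym (cong (±1 F) -1-nonsquare))
      U≡S nothing (just b) = refl
      U≡S (just a) (just b) = refl

      Uᵀ≡-S : ∀ i l → U F l i ≡ - S F i l
      Uᵀ≡-S nothing nothing = refl
      Uᵀ≡-S nothing (just b) = U-just-nothing b
      Uᵀ≡-S (just a) nothing = sym (cong (λ s → - ±1 F s) -1-nonsquare)
      Uᵀ≡-S (just a) (just b) = trans (S-transpose a b) (trans (cong (λ s → ±1 F s * S F (just a) (just b)) -1-nonsquare)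
                                                            (ℤP.-1*i≡-i (S F (just a) (just b))))

    H≡H₃ : ∀ r j → H F r j ≡ H₃ F r j
    H≡H₃ (inj₁ i) (inj₁ l) = cong (_+_ (Id F i l)) (trans (cong -_ (Uᵀ≡-S i l)) (ℤP.neg-involutive (S F i l)))
    H≡H₃ (inj₁ i) (inj₂ l) = trans (cong (_+ Id F i l) (U≡S i l)) (ℤP.+-comm (S F i l) (Id F i l))
    H≡H₃ (inj₂ i) (inj₁ l) = cong (_+_ (Id F i l)) (Uᵀ≡-S i l)
    H≡H₃ (inj₂ i) (inj₂ l) = cong (_- Id F i l) (U≡S i l)

    H∼H₃ : HadamardEquiv F (H F) (H₃ F)
    H∼H₃ = I , I , I-monomial , I-monomial ,
           λ r j → trans (signedPermutation-sandwich (H F) id (λ _ → + 1) (λ _ → + 1) r j)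
                         (trans (trans (ℤP.*-identityʳ _) (ℤP.*-identityˡ _)) (H≡H₃ r j))
      where
      I : Mat F
      I = signedPermutation id (λ _ → + 1)
      I-monomial : IsMonomial F I
      I-monomial = signedPermutation-monomial id (λ _ → refl) (λ _ → + 1) (λ _ → inj₁ refl)

  module _ (-1-square : FiniteField.isSquare F -1# ≡ true) where

    private
      S-just-nothing : ∀ a → S F (just a) nothing ≡ + 1
      S-just-nothing a = cong (±1 F) -1-square

      S-symmetric : ∀ a b → S F (just b) (just a) ≡ S F (just a) (just b)
      S-symmetric a b = trans (S-transpose a b) (trans (cong (λ s → ±1 F s * S F (just a) (just b)) -1-square) (ℤP.*-identityˡ _))

      π : Idx F → Idx F
      π (inj₁ nothing) = inj₁ nothing
      π (inj₂ nothing) = inj₂ nothing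
      π (inj₁ (just a)) = inj₂ (just a)
      π (inj₂ (just a)) = inj₁ (just a)

      π-involutive : ∀ x → π (π x) ≡ x
      π-involutive (inj₁ nothing) = refl
      π-involutive (inj₂ nothing) = refl
      π-involutive (inj₁ (just a)) = refl
      π-involutive (inj₂ (just a)) = refl

      σ ρ : Idx F → ℤ
      σ (inj₁ _) = + 1
      σ (inj₂ _) = -[1+ 0 ]
      ρ (inj₁ _) = + 1
      ρ (inj₂ nothing) = -[1+ 0 ]
      ρ (inj₂ (just _)) = + 1

      σ-signs : ∀ x → IsSign (σ x)
      σ-signs (inj₁ _) = inj₁ refl
      σ-signs (inj₂ _) = inj₂ refl

      ρ-signs : ∀ x → IsSign (ρ x)
      ρ-signs (inj₁ _) = inj₁ refl
      ρ-signs (inj₂ nothing) = inj₂ refl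
      ρ-signs (inj₂ (just _)) = inj₁ refl

      entry : ∀ r j → σ r * H F (π r) j * ρ j ≡ H₁ F r j
      entry (inj₁ nothing) (inj₁ nothing) = refl
      entry (inj₁ nothing) (inj₁ (just b)) = cong (λ u → + 1 * (+ 0 - u) * + 1) (U-just-nothing b)
      entry (inj₁ nothing) (inj₂ nothing) = refl
      entry (inj₁ nothing) (inj₂ (just b)) = refl
      entry (inj₂ nothing) (inj₁ nothing) = refl
      entry (inj₂ nothing) (inj₁ (just b)) = cong (λ u → -[1+ 0 ] * (+ 0 + u) * + 1) (U-just-nothing b)
      entry (inj₂ nothing) (inj₂ nothing) = refl
      entry (inj₂ nothing) (inj₂ (just b)) = refl
      entry (inj₁ (just a)) (inj₁ nothing) = sym (cong (_+_ (+ 0)) (S-just-nothing a))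
      entry (inj₁ (just a)) (inj₁ (just b)) =
        trans (unit (Id F (just a) (just b)) (S F (just b) (just a))) (cong (_+_ (Id F (just a) (just b))) (S-symmetric a b))
        where
        unit : ∀ x y → + 1 * (x + y) * + 1 ≡ x + y
        unit = solve-∀
      entry (inj₁ (just a)) (inj₂ nothing) =
        trans (cong (λ u → + 1 * (u + + 0) * -[1+ 0 ]) (U-just-nothing a)) (sym (cong (_+ + 0) (S-just-nothing a)))
      entry (inj₁ (just a)) (inj₂ (just b)) = unit (S F (just a) (just b)) (Id F (just a) (just b))
        where
        unit : ∀ x y → + 1 * (x - y) * + 1 ≡ x - y
        unit = solve-∀
      entry (inj₂ (just a)) (inj₁ nothing) = sym (cong (_+ + 0) (S-just-nothing a))
      entry (inj₂ (just a)) (inj₁ (just b)) =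
        trans (negate (Id F (just a) (just b)) (S F (just b) (just a))) (cong (_- Id F (just a) (just b)) (S-symmetric a b))
        where
        negate : ∀ x y → -[1+ 0 ] * (x - y) * + 1 ≡ y - x
        negate = solve-∀
      entry (inj₂ (just a)) (inj₂ nothing) =
        trans (cong (λ u → -[1+ 0 ] * (u + + 0) * -[1+ 0 ]) (U-just-nothing a)) (sym (cong (λ s → + 0 - s) (S-just-nothing a)))
      entry (inj₂ (just a)) (inj₂ (just b)) = negate (S F (just a) (just b)) (Id F (just a) (just b))
        where
        negate : ∀ x y → -[1+ 0 ] * (x + y) * + 1 ≡ - y - x
        negate = solve-∀

    H∼H₁ : HadamardEquiv F (H F) (H₁ F)
    H∼H₁ = signedPermutation π σ , signedPermutation id ρ ,
           signedPermutation-monomial π π-involutive σ σ-signs , signedPermutation-monomial id (λ _ → refl) ρ ρ-signs ,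
           λ r j → trans (signedPermutation-sandwich (H F) π σ ρ r j) (entry r j)

open import Data.Nat using (_+_; _∸_; _/_; _%_)

theorem1 : (q : ℕ) → IsPrimePower q → q % 2 ≡ 1 → q % 3 ≡ 2 → (F : FiniteField q) →
    ((∀ j → H F (first F) j ≡ + 1)
    × IsHadamard F (H F)
    × (∀ r → InL F (rowGF3 F (H F) r))
    × (q % 4 ≡ 1 → HadamardEquiv F (H F) (H₁ F))
    × (q % 4 ≡ 3 → HadamardEquiv F (H F) (H₃ F))
    × (∀ (r : Idx F) (s : Bool) → r ≢ first F →
         InL F (blockWord F (H F) r s) × (weight F (blockWord F (H F) r s) ≡ q + 1))
    × (∀ (r r′ : Idx F) (s s′ : Bool) → r ≢ first F → r′ ≢ first F →
         (∀ j → blockWord F (H F) r s j ≡ blockWord F (H F) r′ s′ j) → (r ≡ r′) × (s ≡ s′))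
    × (∀ (x y z : Idx F) → x ≢ y → y ≢ z → x ≢ z →
         countBlocks3 F (H F) x y z ≡ (q ∸ 1) / 2))
theorem1 q _ q-odd q%3≡2 F =
    H-first
  , (H-entries , H-rows-orthogonal)
  , H-rows-in-L q%3≡2
  , (λ q%4≡1 → H∼H₁ (q%4≡1⇒-1-square q%4≡1))
  , (λ q%4≡3 → H∼H₃ (q%4≡3⇒-1-nonsquare q%4≡3))
  , (λ r s r≢first → blocks-in-L q%3≡2 r s , block-weight r s r≢first)
  , (λ r r′ s s′ _ _ → blocks-distinct r r′ s s′)
  , H-3-design
  where
  open QuadraticCharacter F q-odd using (q%4≡1⇒-1-square; q%4≡3⇒-1-nonsquare)
  open PaleyMatrices F q-odd
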